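{- Let $a<b$ be positive integers and set $n=ab$. Then $$\dim\big(F_{a,b}(\mathbf{x};q)\big)=\frac{(ab)!}{1-q}\left(\frac{[b]_q!\,([a]_q!)^b}{b!\,(a!)^b}-\frac{[a]_q!\,([b]_q!)^a}{a!\,(b!)^a}\right),$$ and, letting $q\to 1$, $$\dim\big(F_{a,b}(\mathbf{x};1)\big)=\frac{(ab)!\,(a-1)(b-1)(b-a)}{4}.$$
   Context: Symmetric functions are in variables $\mathbf{x}=x_1,x_2,\dots$, with coefficients rational functions of a parameter $q$. $p_k=\sum_i x_i^k$ are power sums, $p_\mu=p_{\mu_1}p_{\mu_2}\cdots$, $h_n$ the complete homogeneous symmetric functions, $s_\mu$ Schur functions, and $\langle\cdot,\cdot\rangle$ the Hall scalar product (Schur functions orthonormal, $\langle p_\mu,p_\lambda\rangle=\delta_{\mu\lambda}z_\mu$ with $z_\mu=\prod_j j^{d_j}d_j!$, $d_j$ the multiplicity of $j$ in $\mu$). Let $[k]_q=1+q+\dots+q^{k-1}$ and $[n]_q!=[1]_q[2]_q\cdots[n]_q$. Define $$H_n(\mathbf{x};q)=\sum_{\mu\vdash n}\frac{[n]_q!}{z_\mu\,[\mu_1]_q\cdots[\mu_{\ell(\mu)}]_q}(1-q)^{n-\ell(\mu)}p_\mu(\mathbf{x}),$$ equivalently $H_n(\mathbf{x};q)=[n]_q!(1-q)^n h_n[\mathbf{x}/(1-q)]$; so $H_n(\mathbf{x};0)=h_n$ and $H_n(\mathbf{x};1)=p_1^n$. Plethysm $f[g]$ is the operation determined by: $f\mapsto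 f[g]$ is linear and multiplicative in $f$, $p_k[g]$ is linear and multiplicative in $g$, $p_k[p_j]=p_{kj}$ and $p_k[q]=q^k$ (so $p_k[g(\mathbf{x};q)]=g(x_1^k,x_2^k,\dots;q^k)$). For positive integers $a,b$ set $$F_{a,b}(\mathbf{x};q)=\frac{H_b[H_a]-H_a[H_b]}{1-q},$$ which is polynomial in $q$ since the numerator vanishes at $q=1$; $F_{a,b}(\mathbf{x};1)$ denotes its value at $q=1$. For $f$ homogeneous of degree $n$, $\dim(f):=\langle p_1^n,f\rangle$. -}

module Defs where

open import Data.Nat as ℕ using (ℕ; zero; suc; _∸_; _⊓_; _!)
open import Data.Integer using (+_)
open import Data.Rational using (ℚ; 0ℚ; 1ℚ; _+_; _*_; -_; _/_)
open import Data.List using (List; []; _∷_; map; concatMap; applyUpTo; foldr; length; replicate; _++_; upTo; filter)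
open import Data.List.Properties using (≡-dec)
open import Data.Product using (_×_; _,_)
open import Relation.Nullary using (yes; no)
open import Relation.Binary.PropositionalEquality using (_≡_)

fromℕℚ : ℕ → ℚ
fromℕℚ n = (+ n) / 1

-- reciprocal of a positive natural (the value at 0 is irrelevant: only
-- applied to positive numbers, namely z_μ and factorial products)
recipℕ : ℕ → ℚ
recipℕ zero    = 0ℚ
recipℕ (suc k) = (+ 1) / suc k

-- Polynomials in q with rational coefficients, as coefficient lists
-- (constant term first).  Equality is coefficientwise (_≈P_).

Poly : Set
Poly = List ℚ

_+P_ : Poly → Poly → Poly
[]      +P q       = q
(a ∷ p) +P []      = a ∷ p
(a ∷ p) +P (b ∷ q) = (a + b) ∷ (p +P q)

_·P_ : ℚ → Poly → Poly
c ·P p = map (c *_) p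

-P_ : Poly → Poly
-P p = map -_ p

_-P_ : Poly → Poly → Poly
p -P q = p +P (-P q)

_*P_ : Poly → Poly → Poly
[]      *P q = []
(a ∷ p) *P q = (a ·P q) +P (0ℚ ∷ (p *P q))

oneP : Poly
oneP = 1ℚ ∷ []

_^P_ : Poly → ℕ → Poly
p ^P zero  = oneP
p ^P suc n = p *P (p ^P n)

coeffP : ℕ → Poly → ℚ
coeffP i       []      = 0ℚ
coeffP zero    (a ∷ p) = a
coeffP (suc i) (a ∷ p) = coeffP i p

_≈P_ : Poly → Poly → Set
p ≈P q = ∀ i → coeffP i p ≡ coeffP i q

evalP : ℚ → Poly → ℚ
evalP x []      = 0ℚ
evalP x (a ∷ p) = a + x * evalP x p

-- p(q) ↦ p(q^k)   (used for k ≥ 1)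
substPow : ℕ → Poly → Poly
substPow k []      = []
substPow k (a ∷ p) = a ∷ (replicate (k ∸ 1) 0ℚ ++ substPow k p)

oneMinusQ : Poly
oneMinusQ = 1ℚ ∷ (- 1ℚ) ∷ []

qint : ℕ → Poly
qint k = replicate k 1ℚ

qfact : ℕ → Poly
qfact zero    = oneP
qfact (suc n) = qint (suc n) *P qfact n

-- Exact division by a polynomial of the form 1 + q·r:
-- the first (length p) coefficients of the power series p / (1 + q r).
-- When (1 + q r) divides p in ℚ[q], this is exactly the quotient.
divS : ℕ → Poly → Poly → Poly
divS zero    p       r = []
divS (suc f) []      r = []
divS (suc f) (c ∷ p) r = c ∷ divS f (p -P (c ·P r)) r

divOnePlusQ : Poly → Poly → Poly
divOnePlusQ p r = divS (length p) p r

-- p / [k]_q   (k ≥ 1, [k]_q = 1 + q [k-1]_q)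
divQInt : ℕ → Poly → Poly
divQInt k p = divOnePlusQ p (qint (k ∸ 1))

-- p / (1 - q)    (1 - q = 1 + q·(-1))
divOneMinusQ : Poly → Poly
divOneMinusQ p = divOnePlusQ p ((- 1ℚ) ∷ [])

-- Partitions: weakly decreasing lists of positive naturals

-- partitions of n with all parts ≤ m (fuel f ≥ n)
partsB : ℕ → ℕ → ℕ → List (List ℕ)
partsB f       zero    m = [] ∷ []
partsB zero    (suc n) m = []
partsB (suc f) (suc n) m =
  concatMap (λ k → map (k ∷_) (partsB f (suc n ∸ k) k)) (applyUpTo suc (suc n ⊓ m))

partitions : ℕ → List (List ℕ)
partitions n = partsB n n n

insertD : ℕ → List ℕ → List ℕ
insertD k []      = k ∷ []
insertD k (j ∷ l) with k ℕ.≥? j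
... | yes _ = k ∷ j ∷ l
... | no  _ = j ∷ insertD k l

sortD : List ℕ → List ℕ
sortD = foldr insertD []

countℕ : ℕ → List ℕ → ℕ
countℕ j l = length (filter (ℕ._≟ j) l)

sumℕ : List ℕ → ℕ
sumℕ = foldr ℕ._+_ 0

prodℕ : List ℕ → ℕ
prodℕ = foldr ℕ._*_ 1

-- z_μ = ∏_j j^{d_j} d_j!
zee : List ℕ → ℕ
zee μ = prodℕ μ ℕ.* prodℕ (map (λ j → countℕ j μ !) (upTo (suc (sumℕ μ))))

-- Symmetric functions in the power-sum basis: formal finite sums
-- Σ c · p_μ, with μ a partition (weakly decreasing list), coefficients in R.

SymF : Set → Set
SymF R = List (R × List ℕ)

-- coefficient ring ℚ(q): here ℚ[q] suffices (all H_n and F_{a,b} are polynomial in q)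
SymP : Set
SymP = SymF Poly

oneSym : SymP
oneSym = (oneP , []) ∷ []

mulSym : SymP → SymP → SymP
mulSym f g = concatMap (λ { (c , μ) → map (λ { (d , λ′) → (c *P d , sortD (μ ++ λ′)) }) g }) f

prodSym : List SymP → SymP
prodSym = foldr mulSym oneSym

negSym : SymP → SymP
negSym = map (λ { (c , μ) → (-P c , μ) })

_-Sym_ : SymP → SymP → SymP
f -Sym g = f ++ negSym g

coeffSym : List ℕ → SymP → Poly
coeffSym μ []             = []
coeffSym μ ((c , λ′) ∷ f) with ≡-dec ℕ._≟_ μ λ′
... | yes _ = c +P coeffSym μ f
... | no  _ = coeffSym μ f

-- p_k[g] = g(x_1^k, x_2^k, ... ; q^k)
pk[_] : ℕ → SymP → SymP
pk[ k ] g = map (λ { (c , μ) → (substPow k c , map (k ℕ.*_) μ) }) g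

-- plethysm f[g]: linear (over ℚ(q)) and multiplicative in f
pleth : SymP → SymP → SymP
pleth f g = concatMap (λ { (c , μ) →
              map (λ { (d , λ′) → (c *P d , λ′) }) (prodSym (map (λ k → pk[ k ] g) μ)) }) f

divQInts : List ℕ → Poly → Poly
divQInts μ p = foldr divQInt p μ

Hcoeff : ℕ → List ℕ → Poly
Hcoeff n μ = recipℕ (zee μ) ·P (divQInts μ (qfact n) *P (oneMinusQ ^P (n ∸ length μ)))

H : ℕ → SymP
H n = map (λ μ → (Hcoeff n μ , μ)) (partitions n)

-- F_{a,b} = (H_b[H_a] - H_a[H_b]) / (1 - q), homogeneous of degree ab;
-- the numerator is collected in the p_μ basis (μ ⊢ ab) before dividing.
F : ℕ → ℕ → SymP
F a b = map (λ μ → (divOneMinusQ (coeffSym μ num) , μ)) (partitions (a ℕ.* b))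
  where num = pleth (H b) (H a) -Sym pleth (H a) (H b)

at1 : SymP → SymF ℚ
at1 = map (λ { (c , μ) → (evalP 1ℚ c , μ) })

-- Hall scalar product ⟨p_μ, p_λ⟩ = δ_{μλ} z_μ, and dim f = ⟨p_1^n, f⟩

hallP : SymP → SymP → Poly
hallP f g = foldr _+P_ [] (concatMap (λ { (c , μ) → map (λ { (d , λ′) →
  (case≡ μ λ′ (fromℕℚ (zee μ) ·P (c *P d))) }) g }) f)
  where
  case≡ : List ℕ → List ℕ → Poly → Poly
  case≡ μ λ′ x with ≡-dec ℕ._≟_ μ λ′
  ... | yes _ = x
  ... | no  _ = []

hallQ : SymF ℚ → SymF ℚ → ℚ
hallQ f g = foldr _+_ 0ℚ (concatMap (λ { (c , μ) → map (λ { (d , λ′) →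
  (case≡ μ λ′ (fromℕℚ (zee μ) * (c * d))) }) g }) f)
  where
  case≡ : List ℕ → List ℕ → ℚ → ℚ
  case≡ μ λ′ x with ≡-dec ℕ._≟_ μ λ′
  ... | yes _ = x
  ... | no  _ = 0ℚ

dimP : ℕ → SymP → Poly
dimP n f = hallP ((oneP , replicate n 1) ∷ []) f

dimQ : ℕ → SymF ℚ → ℚ
dimQ n f = hallQ ((1ℚ , replicate n 1) ∷ []) f

module Submission where

-- The Hall pairing with p_1^n sees only the coefficient of p_1^n: dim f = n! · [p_1^n] f. In the
-- plethysm H_b[H_a] the monomial p_1^{ab} can only come from the term p_1^b of H_b, since p_k[H_a]
-- involves only parts divisible by k; hence [p_1^{ab}] H_b[H_a] = ([p_1^b] H_b) ([p_1^a] H_a)^b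
-- = [b]_q! ([a]_q!)^b / (b! (a!)^b). Both such terms take the value 1 at q = 1, so their difference
-- is divisible by 1 - q, and the value at q = 1 of the quotient is minus the derivative at 1 of the
-- difference. Logarithmic derivatives at 1 add under products, and that of [n]_q! is n(n - 1)/4
-- (the mean number of inversions of a permutation of n), which leaves
-- (ab)!/4 · ((a(a-1) + a·b(b-1)) - (b(b-1) + b·a(a-1))) = (ab)! (a-1)(b-1)(b-a)/4.

open import Defs
open import Data.Nat using (ℕ; _<_; _∸_; _^_)
open import Data.Nat using (_!)
open import Data.Integer using (+_)
open import Data.Rational using (_/_)
open import Data.Product using (_×_)
open import Relation.Binary.PropositionalEquality using (_≡_)

open import Data.Bool using (Bool; true; false; _∧_; if_then_else_)
import Data.Bool.Properties as BoolP
open import Data.Empty using (⊥-elim)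
import Data.Integer as ℤ
import Data.Integer.Properties as ℤP
open import Data.List using (List; []; _∷_; length; replicate; _++_; map; foldr; concatMap; applyUpTo; upTo)
open import Data.List.Properties as ListP using (≡-dec)
open import Data.List.Relation.Unary.All as All using (All; []; _∷_)
import Data.List.Relation.Unary.All.Properties as AllP
open import Data.Nat as ℕ using (zero; suc; _≤_; z≤n; s≤s; NonZero; _⊓_)
import Data.Nat.ListAction.Properties as ListActionP
open import Data.Nat.Properties as ℕP using (_!≢0)
open import Data.Product using (_,_; proj₁; proj₂)
open import Data.Rational using (ℚ; 0ℚ; 1ℚ; _+_; _*_; -_; _-_; toℚᵘ)
import Data.Rational.Properties as ℚP
open import Data.Rational.Solver using (module +-*-Solver)
import Data.Rational.Unnormalised as ℚᵘ
import Data.Rational.Unnormalised.Properties as ℚᵘP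
open import Function using (_∘′_)
open import Level using (0ℓ)
open import Relation.Binary.Bundles using (Setoid)
open import Relation.Binary.PropositionalEquality using (_≢_; refl; sym; trans; cong; cong₂; subst; module ≡-Reasoning)
import Relation.Binary.Reasoning.Setoid as SetoidReasoning
open import Relation.Nullary using (yes; no)

open +-*-Solver using (solve; _:+_; _:*_; _:=_; :-_; con)
open import Algebra.Properties.CommutativeSemigroup ℕP.+-commutativeSemigroup using () renaming (x∙yz≈y∙xz to +-left-comm)

-- Identities involving fromℕℚ and recipℕ are transported from ℚᵘ, where they reduce to
-- cross-multiplied identities in ℤ.

private
  toℚᵘ-fromℕℚ : ∀ n → toℚᵘ (fromℕℚ n) ℚᵘ.≃ ℚᵘ.mkℚᵘ (+ n) 0
  toℚᵘ-fromℕℚ n = ℚP.toℚᵘ-fromℚᵘ (ℚᵘ.mkℚᵘ (+ n) 0)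

fromℕℚ-+ : ∀ m n → fromℕℚ (m ℕ.+ n) ≡ fromℕℚ m + fromℕℚ n
fromℕℚ-+ m n = ℚP.toℚᵘ-injective (ℚᵘP.≃-trans (toℚᵘ-fromℕℚ (m ℕ.+ n)) (ℚᵘP.≃-trans (ℚᵘ.*≡* eq)
  (ℚᵘP.≃-sym (ℚᵘP.≃-trans (ℚP.toℚᵘ-homo-+ (fromℕℚ m) (fromℕℚ n))
                          (ℚᵘP.+-cong (toℚᵘ-fromℕℚ m) (toℚᵘ-fromℕℚ n))))))
  where
  eq : + (m ℕ.+ n) ℤ.* + 1 ≡ (+ m ℤ.* + 1 ℤ.+ + n ℤ.* + 1) ℤ.* + 1
  eq = cong (ℤ._* + 1) (trans (ℤP.pos-+ m n) (sym (cong₂ ℤ._+_ (ℤP.*-identityʳ (+ m)) (ℤP.*-identityʳ (+ n)))))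

fromℕℚ-* : ∀ m n → fromℕℚ (m ℕ.* n) ≡ fromℕℚ m * fromℕℚ n
fromℕℚ-* m n = ℚP.toℚᵘ-injective (ℚᵘP.≃-trans (toℚᵘ-fromℕℚ (m ℕ.* n)) (ℚᵘP.≃-trans (ℚᵘ.*≡* eq)
  (ℚᵘP.≃-sym (ℚᵘP.≃-trans (ℚP.toℚᵘ-homo-* (fromℕℚ m) (fromℕℚ n))
                          (ℚᵘP.*-cong (toℚᵘ-fromℕℚ m) (toℚᵘ-fromℕℚ n))))))
  where
  eq : + (m ℕ.* n) ℤ.* + 1 ≡ (+ m ℤ.* + n) ℤ.* + 1
  eq = cong (ℤ._* + 1) (ℤP.pos-* m n)

fromℕℚ-∸ : ∀ {m n} → n ≤ m → fromℕℚ (m ∸ n) ≡ fromℕℚ m - fromℕℚ n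
fromℕℚ-∸ {m} {n} n≤m = begin
  fromℕℚ (m ∸ n)                              ≡⟨ solve 2 (λ x y → x := (x :+ y) :+ (:- y)) refl (fromℕℚ (m ∸ n)) (fromℕℚ n) ⟩
  (fromℕℚ (m ∸ n) + fromℕℚ n) - fromℕℚ n      ≡⟨ cong (_- fromℕℚ n) (sym (fromℕℚ-+ (m ∸ n) n)) ⟩
  fromℕℚ (m ∸ n ℕ.+ n) - fromℕℚ n             ≡⟨ cong (λ k → fromℕℚ k - fromℕℚ n) (ℕP.m∸n+n≡m n≤m) ⟩
  fromℕℚ m - fromℕℚ n                         ∎
  where open ≡-Reasoning

recipℕ-inverse : ∀ n .{{_ : NonZero n}} → recipℕ n * fromℕℚ n ≡ 1ℚ
recipℕ-inverse (suc k) = ℚP.toℚᵘ-injective (ℚᵘP.≃-trans (ℚP.toℚᵘ-homo-* (recipℕ (suc k)) (fromℕℚ (suc k)))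
  (ℚᵘP.≃-trans (ℚᵘP.*-cong (ℚP.toℚᵘ-fromℚᵘ (ℚᵘ.mkℚᵘ (+ 1) k)) (toℚᵘ-fromℕℚ (suc k))) (ℚᵘ.*≡* eq)))
  where
  eq : + 1 ℤ.* + suc k ℤ.* + 1 ≡ + 1 ℤ.* + (suc k ℕ.* 1)
  eq = cong (λ x → + suc x) (trans (ℕP.*-identityʳ _) (trans (ℕP.+-identityʳ k) (sym (trans (ℕP.+-identityʳ _) (ℕP.*-identityʳ k)))))

private
  inverse-unique : ∀ {r s u} → r * u ≡ 1ℚ → s * u ≡ 1ℚ → r ≡ s
  inverse-unique {r} {s} {u} ru≡1 su≡1 = begin
    r                ≡⟨ sym (ℚP.*-identityʳ r) ⟩
    r * 1ℚ           ≡⟨ cong (r *_) (sym su≡1) ⟩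
    r * (s * u)      ≡⟨ solve 3 (λ r s u → r :* (s :* u) := s :* (r :* u)) refl r s u ⟩
    s * (r * u)      ≡⟨ cong (s *_) ru≡1 ⟩
    s * 1ℚ           ≡⟨ ℚP.*-identityʳ s ⟩
    s                ∎
    where open ≡-Reasoning

recipℕ-* : ∀ m n .{{_ : NonZero m}} .{{_ : NonZero n}} → recipℕ (m ℕ.* n) ≡ recipℕ m * recipℕ n
recipℕ-* m n = inverse-unique (recipℕ-inverse (m ℕ.* n) {{ℕP.m*n≢0 m n}}) (begin
  recipℕ m * recipℕ n * fromℕℚ (m ℕ.* n)
    ≡⟨ cong (recipℕ m * recipℕ n *_) (fromℕℚ-* m n) ⟩
  recipℕ m * recipℕ n * (fromℕℚ m * fromℕℚ n)
    ≡⟨ solve 4 (λ a b c d → a :* b :* (c :* d) := (a :* c) :* (b :* d)) refl (recipℕ m) (recipℕ n) (fromℕℚ m) (fromℕℚ n) ⟩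
  (recipℕ m * fromℕℚ m) * (recipℕ n * fromℕℚ n)
    ≡⟨ cong₂ _*_ (recipℕ-inverse m) (recipℕ-inverse n) ⟩
  1ℚ * 1ℚ
    ≡⟨⟩
  1ℚ                                                   ∎)
  where open ≡-Reasoning

fromℕℚ-*-cancelˡ : ∀ n .{{_ : NonZero n}} {x y} → fromℕℚ n * x ≡ y → x ≡ y * recipℕ n
fromℕℚ-*-cancelˡ n {x} {y} nx≡y = begin
  x                              ≡⟨ sym (ℚP.*-identityʳ x) ⟩
  x * 1ℚ                         ≡⟨ cong (x *_) (sym (recipℕ-inverse n)) ⟩
  x * (recipℕ n * fromℕℚ n)      ≡⟨ solve 3 (λ x r m → x :* (r :* m) := (m :* x) :* r) refl x (recipℕ n) (fromℕℚ n) ⟩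
  fromℕℚ n * x * recipℕ n        ≡⟨ cong (_* recipℕ n) nx≡y ⟩
  y * recipℕ n                   ∎
  where open ≡-Reasoning

/-as-recipℕ : ∀ k n → (+ k) / suc n ≡ fromℕℚ k * recipℕ (suc n)
/-as-recipℕ k n = ℚP.toℚᵘ-injective (ℚᵘP.≃-trans (ℚP.toℚᵘ-fromℚᵘ (ℚᵘ.mkℚᵘ (+ k) n))
  (ℚᵘP.≃-sym (ℚᵘP.≃-trans (ℚP.toℚᵘ-homo-* (fromℕℚ k) (recipℕ (suc n)))
    (ℚᵘP.≃-trans (ℚᵘP.*-cong (toℚᵘ-fromℕℚ k) (ℚP.toℚᵘ-fromℚᵘ (ℚᵘ.mkℚᵘ (+ 1) n))) (ℚᵘ.*≡* eq)))))
  where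
  eq : + k ℤ.* + 1 ℤ.* + suc n ≡ + k ℤ.* + suc (n ℕ.+ 0)
  eq = cong₂ ℤ._*_ (ℤP.*-identityʳ (+ k)) (cong (λ m → + suc m) (sym (ℕP.+-identityʳ n)))

-- a record, so that p and q can be recovered from a proof of p ≋ q by unification
infix 4 _≋_
record _≋_ (p q : Poly) : Set where
  constructor mk≋
  field coeff≡ : p ≈P q
open _≋_

≋-refl : ∀ {p} → p ≋ p
≋-refl = mk≋ λ _ → refl

≋-sym : ∀ {p q} → p ≋ q → q ≋ p
≋-sym (mk≋ e) = mk≋ λ i → sym (e i)

≋-trans : ∀ {p q r} → p ≋ q → q ≋ r → p ≋ r
≋-trans (mk≋ e) (mk≋ f) = mk≋ λ i → trans (e i) (f i)

≋-reflexive : ∀ {p q} → p ≡ q → p ≋ q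
≋-reflexive refl = ≋-refl

≋-setoid : Setoid 0ℓ 0ℓ
≋-setoid = record { Carrier = Poly ; _≈_ = _≋_
                  ; isEquivalence = record { refl = ≋-refl ; sym = ≋-sym ; trans = ≋-trans } }

module ≋-Reasoning = SetoidReasoning ≋-setoid

∷-cong : ∀ {a b p q} → a ≡ b → p ≋ q → a ∷ p ≋ b ∷ q
∷-cong a≡b (mk≋ e) = mk≋ λ { zero → a≡b ; (suc i) → e i }

∷≋[] : ∀ {a p} → a ≡ 0ℚ → p ≋ [] → a ∷ p ≋ []
∷≋[] a≡0 (mk≋ e) = mk≋ λ { zero → a≡0 ; (suc i) → e i }

∷≋[]⁻¹ : ∀ {a p} → a ∷ p ≋ [] → (a ≡ 0ℚ) × (p ≋ [])
∷≋[]⁻¹ (mk≋ e) = e zero , mk≋ (λ i → e (suc i))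

coeffP-+P : ∀ i p q → coeffP i (p +P q) ≡ coeffP i p + coeffP i q
coeffP-+P i       []      q       = sym (ℚP.+-identityˡ _)
coeffP-+P i       (a ∷ p) []      = sym (ℚP.+-identityʳ _)
coeffP-+P zero    (a ∷ p) (b ∷ q) = refl
coeffP-+P (suc i) (a ∷ p) (b ∷ q) = coeffP-+P i p q

coeffP-·P : ∀ i c p → coeffP i (c ·P p) ≡ c * coeffP i p
coeffP-·P i       c []      = sym (ℚP.*-zeroʳ c)
coeffP-·P zero    c (a ∷ p) = refl
coeffP-·P (suc i) c (a ∷ p) = coeffP-·P i c p

coeffP--P : ∀ i p → coeffP i (-P p) ≡ - coeffP i p
coeffP--P i       []      = refl
coeffP--P zero    (a ∷ p) = refl
coeffP--P (suc i) (a ∷ p) = coeffP--P i p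

coeffP-*P-zero : ∀ a p q → coeffP zero ((a ∷ p) *P q) ≡ a * coeffP zero q
coeffP-*P-zero a p q = trans (coeffP-+P zero (a ·P q) (0ℚ ∷ (p *P q)))
  (trans (cong (_+ 0ℚ) (coeffP-·P zero a q)) (ℚP.+-identityʳ _))

coeffP-*P-suc : ∀ i a p q → coeffP (suc i) ((a ∷ p) *P q) ≡ a * coeffP (suc i) q + coeffP i (p *P q)
coeffP-*P-suc i a p q = trans (coeffP-+P (suc i) (a ·P q) (0ℚ ∷ (p *P q)))
  (cong (_+ coeffP i (p *P q)) (coeffP-·P (suc i) a q))

+P-cong : ∀ {p p′ q q′} → p ≋ p′ → q ≋ q′ → p +P q ≋ p′ +P q′
+P-cong {p} {p′} {q} {q′} (mk≋ e) (mk≋ f) = mk≋ λ i →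
  trans (coeffP-+P i p q) (trans (cong₂ _+_ (e i) (f i)) (sym (coeffP-+P i p′ q′)))

+P-congʳ : ∀ p {q q′} → q ≋ q′ → p +P q ≋ p +P q′
+P-congʳ p = +P-cong (≋-refl {p})

·P-congʳ : ∀ c {p p′} → p ≋ p′ → c ·P p ≋ c ·P p′
·P-congʳ c {p} {p′} (mk≋ e) = mk≋ λ i →
  trans (coeffP-·P i c p) (trans (cong (c *_) (e i)) (sym (coeffP-·P i c p′)))

-P-cong : ∀ {p p′} → p ≋ p′ → -P p ≋ -P p′
-P-cong {p} {p′} (mk≋ e) = mk≋ λ i →
  trans (coeffP--P i p) (trans (cong -_ (e i)) (sym (coeffP--P i p′)))

+P-identityʳ : ∀ p → p +P [] ≡ p
+P-identityʳ []      = refl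
+P-identityʳ (a ∷ p) = refl

+P-assoc : ∀ p q r → (p +P q) +P r ≋ p +P (q +P r)
+P-assoc p q r = mk≋ λ i → begin
  coeffP i ((p +P q) +P r)                     ≡⟨ coeffP-+P i (p +P q) r ⟩
  coeffP i (p +P q) + coeffP i r               ≡⟨ cong (_+ coeffP i r) (coeffP-+P i p q) ⟩
  coeffP i p + coeffP i q + coeffP i r         ≡⟨ ℚP.+-assoc (coeffP i p) (coeffP i q) (coeffP i r) ⟩
  coeffP i p + (coeffP i q + coeffP i r)       ≡⟨ cong (λ x → coeffP i p + x) (coeffP-+P i q r) ⟨
  coeffP i p + coeffP i (q +P r)               ≡⟨ coeffP-+P i p (q +P r) ⟨
  coeffP i (p +P (q +P r))                     ∎
  where open ≡-Reasoning

+-middle-four : ∀ (x y z w : ℚ) → (x + y) + (z + w) ≡ (x + z) + (y + w)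
+-middle-four = solve 4 (λ x y z w → (x :+ y) :+ (z :+ w) := (x :+ z) :+ (y :+ w)) refl

+P-middle-four : ∀ p q r s → (p +P q) +P (r +P s) ≋ (p +P r) +P (q +P s)
+P-middle-four p q r s = mk≋ λ i → begin
  coeffP i ((p +P q) +P (r +P s))                               ≡⟨ coeffP-+P i (p +P q) (r +P s) ⟩
  coeffP i (p +P q) + coeffP i (r +P s)                         ≡⟨ cong₂ _+_ (coeffP-+P i p q) (coeffP-+P i r s) ⟩
  (coeffP i p + coeffP i q) + (coeffP i r + coeffP i s)         ≡⟨ +-middle-four (coeffP i p) (coeffP i q) (coeffP i r) (coeffP i s) ⟩
  (coeffP i p + coeffP i r) + (coeffP i q + coeffP i s)         ≡⟨ cong₂ _+_ (coeffP-+P i p r) (coeffP-+P i q s) ⟨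
  coeffP i (p +P r) + coeffP i (q +P s)                         ≡⟨ coeffP-+P i (p +P r) (q +P s) ⟨
  coeffP i ((p +P r) +P (q +P s))                               ∎
  where open ≡-Reasoning

-P-distrib-+P : ∀ p q → -P (p +P q) ≋ (-P p) +P (-P q)
-P-distrib-+P p q = mk≋ λ i → begin
  coeffP i (-P (p +P q))                   ≡⟨ coeffP--P i (p +P q) ⟩
  - coeffP i (p +P q)                      ≡⟨ cong -_ (coeffP-+P i p q) ⟩
  - (coeffP i p + coeffP i q)              ≡⟨ ℚP.neg-distrib-+ (coeffP i p) (coeffP i q) ⟩
  - coeffP i p + - coeffP i q              ≡⟨ cong₂ _+_ (coeffP--P i p) (coeffP--P i q) ⟨
  coeffP i (-P p) + coeffP i (-P q)        ≡⟨ coeffP-+P i (-P p) (-P q) ⟨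
  coeffP i ((-P p) +P (-P q))              ∎
  where open ≡-Reasoning

·P-distrib-+P : ∀ c p q → c ·P (p +P q) ≋ (c ·P p) +P (c ·P q)
·P-distrib-+P c p q = mk≋ λ i → begin
  coeffP i (c ·P (p +P q))                 ≡⟨ coeffP-·P i c (p +P q) ⟩
  c * coeffP i (p +P q)                    ≡⟨ cong (c *_) (coeffP-+P i p q) ⟩
  c * (coeffP i p + coeffP i q)            ≡⟨ ℚP.*-distribˡ-+ c (coeffP i p) (coeffP i q) ⟩
  c * coeffP i p + c * coeffP i q          ≡⟨ cong₂ _+_ (coeffP-·P i c p) (coeffP-·P i c q) ⟨
  coeffP i (c ·P p) + coeffP i (c ·P q)    ≡⟨ coeffP-+P i (c ·P p) (c ·P q) ⟨
  coeffP i ((c ·P p) +P (c ·P q))          ∎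
  where open ≡-Reasoning

·P-assoc : ∀ c d p → c ·P (d ·P p) ≋ (c * d) ·P p
·P-assoc c d p = mk≋ λ i → begin
  coeffP i (c ·P (d ·P p))     ≡⟨ coeffP-·P i c (d ·P p) ⟩
  c * coeffP i (d ·P p)        ≡⟨ cong (c *_) (coeffP-·P i d p) ⟩
  c * (d * coeffP i p)         ≡⟨ ℚP.*-assoc c d (coeffP i p) ⟨
  c * d * coeffP i p           ≡⟨ coeffP-·P i (c * d) p ⟨
  coeffP i ((c * d) ·P p)      ∎
  where open ≡-Reasoning

·P-identityˡ : ∀ p → 1ℚ ·P p ≋ p
·P-identityˡ p = mk≋ λ i → trans (coeffP-·P i 1ℚ p) (ℚP.*-identityˡ (coeffP i p))

·P-zeroˡ : ∀ p → 0ℚ ·P p ≋ []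
·P-zeroˡ p = mk≋ λ i → trans (coeffP-·P i 0ℚ p) (ℚP.*-zeroˡ (coeffP i p))

*P-zeroʳ : ∀ p → p *P [] ≋ []
*P-zeroʳ []      = ≋-refl
*P-zeroʳ (a ∷ p) = ∷≋[] refl (*P-zeroʳ p)

*P-zeroˡ : ∀ {p} q → p ≋ [] → p *P q ≋ []
*P-zeroˡ {[]}    q p≋0 = ≋-refl
*P-zeroˡ {a ∷ p} q p≋0 with ∷≋[]⁻¹ p≋0
... | a≡0 , p′≋0 = begin
  (a ·P q) +P (0ℚ ∷ (p *P q))
    ≈⟨ +P-cong (≋-trans (≋-reflexive (cong (_·P q) a≡0)) (·P-zeroˡ q)) (∷≋[] refl (*P-zeroˡ q p′≋0)) ⟩
  [] +P []
    ≡⟨⟩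
  []
    ∎
  where open ≋-Reasoning

·P-distribʳ-+ : ∀ c d p → (c + d) ·P p ≋ (c ·P p) +P (d ·P p)
·P-distribʳ-+ c d p = mk≋ λ i → begin
  coeffP i ((c + d) ·P p)                  ≡⟨ coeffP-·P i (c + d) p ⟩
  (c + d) * coeffP i p                     ≡⟨ ℚP.*-distribʳ-+ (coeffP i p) c d ⟩
  c * coeffP i p + d * coeffP i p          ≡⟨ cong₂ _+_ (coeffP-·P i c p) (coeffP-·P i d p) ⟨
  coeffP i (c ·P p) + coeffP i (d ·P p)    ≡⟨ coeffP-+P i (c ·P p) (d ·P p) ⟨
  coeffP i ((c ·P p) +P (d ·P p))          ∎
  where open ≡-Reasoning

*P-congʳ : ∀ p {q q′} → q ≋ q′ → p *P q ≋ p *P q′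
*P-congʳ []      q≋q′ = ≋-refl
*P-congʳ (a ∷ p) q≋q′ = +P-cong (·P-congʳ a q≋q′) (∷-cong refl (*P-congʳ p q≋q′))

*P-congˡ : ∀ {p p′} q → p ≋ p′ → p *P q ≋ p′ *P q
*P-congˡ {[]}    {p′}     q p≋p′ = ≋-sym (*P-zeroˡ q (≋-sym p≋p′))
*P-congˡ {a ∷ p} {[]}     q p≋p′ = *P-zeroˡ q p≋p′
*P-congˡ {a ∷ p} {a′ ∷ p′} q (mk≋ e) =
  +P-cong (≋-reflexive (cong (_·P q) (e zero))) (∷-cong refl (*P-congˡ {p} {p′} q (mk≋ λ i → e (suc i))))

*P-cong : ∀ {p p′ q q′} → p ≋ p′ → q ≋ q′ → p *P q ≋ p′ *P q′
*P-cong {p′ = p′} {q = q} p≋p′ q≋q′ = ≋-trans (*P-congˡ q p≋p′) (*P-congʳ p′ q≋q′)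

^P-congˡ : ∀ {p p′} n → p ≋ p′ → p ^P n ≋ p′ ^P n
^P-congˡ zero    p≋p′ = ≋-refl
^P-congˡ (suc n) p≋p′ = *P-cong p≋p′ (^P-congˡ n p≋p′)

*P-distribʳ : ∀ p p′ q → (p +P p′) *P q ≋ (p *P q) +P (p′ *P q)
*P-distribʳ []      p′        q = ≋-refl
*P-distribʳ (a ∷ p) []        q = ≋-reflexive (sym (+P-identityʳ _))
*P-distribʳ (a ∷ p) (a′ ∷ p′) q = begin
  ((a + a′) ·P q) +P (0ℚ ∷ ((p +P p′) *P q))
    ≈⟨ +P-cong (·P-distribʳ-+ a a′ q) (∷-cong (sym (ℚP.+-identityʳ 0ℚ)) (*P-distribʳ p p′ q)) ⟩
  ((a ·P q) +P (a′ ·P q)) +P ((0ℚ ∷ (p *P q)) +P (0ℚ ∷ (p′ *P q)))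
    ≈⟨ +P-middle-four (a ·P q) (a′ ·P q) (0ℚ ∷ (p *P q)) (0ℚ ∷ (p′ *P q)) ⟩
  ((a ·P q) +P (0ℚ ∷ (p *P q))) +P ((a′ ·P q) +P (0ℚ ∷ (p′ *P q)))
    ∎
  where open ≋-Reasoning

*P-distribˡ : ∀ p q q′ → p *P (q +P q′) ≋ (p *P q) +P (p *P q′)
*P-distribˡ []      q q′ = ≋-refl
*P-distribˡ (a ∷ p) q q′ = begin
  (a ·P (q +P q′)) +P (0ℚ ∷ (p *P (q +P q′)))
    ≈⟨ +P-cong (·P-distrib-+P a q q′) (∷-cong (sym (ℚP.+-identityʳ 0ℚ)) (*P-distribˡ p q q′)) ⟩
  ((a ·P q) +P (a ·P q′)) +P ((0ℚ ∷ (p *P q)) +P (0ℚ ∷ (p *P q′)))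
    ≈⟨ +P-middle-four (a ·P q) (a ·P q′) (0ℚ ∷ (p *P q)) (0ℚ ∷ (p *P q′)) ⟩
  ((a ·P q) +P (0ℚ ∷ (p *P q))) +P ((a ·P q′) +P (0ℚ ∷ (p *P q′)))
    ∎
  where open ≋-Reasoning

·P-*P-assoc : ∀ c p q → (c ·P p) *P q ≋ c ·P (p *P q)
·P-*P-assoc c []      q = ≋-refl
·P-*P-assoc c (a ∷ p) q = begin
  ((c * a) ·P q) +P (0ℚ ∷ ((c ·P p) *P q))
    ≈⟨ +P-cong (≋-sym (·P-assoc c a q)) (∷-cong (sym (ℚP.*-zeroʳ c)) (·P-*P-assoc c p q)) ⟩
  (c ·P (a ·P q)) +P (c ·P (0ℚ ∷ (p *P q)))
    ≈⟨ ·P-distrib-+P c (a ·P q) (0ℚ ∷ (p *P q)) ⟨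
  c ·P ((a ·P q) +P (0ℚ ∷ (p *P q)))
    ∎
  where open ≋-Reasoning

*P-·P-comm : ∀ c p q → p *P (c ·P q) ≋ c ·P (p *P q)
*P-·P-comm c []      q = ≋-refl
*P-·P-comm c (a ∷ p) q = begin
  (a ·P (c ·P q)) +P (0ℚ ∷ (p *P (c ·P q)))
    ≈⟨ +P-cong a·c·q≋c·a·q (∷-cong (sym (ℚP.*-zeroʳ c)) (*P-·P-comm c p q)) ⟩
  (c ·P (a ·P q)) +P (c ·P (0ℚ ∷ (p *P q)))
    ≈⟨ ·P-distrib-+P c (a ·P q) (0ℚ ∷ (p *P q)) ⟨
  c ·P ((a ·P q) +P (0ℚ ∷ (p *P q)))
    ∎
  where
  open ≋-Reasoning
  a·c·q≋c·a·q : a ·P (c ·P q) ≋ c ·P (a ·P q)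
  a·c·q≋c·a·q = ≋-trans (·P-assoc a c q)
    (≋-trans (≋-reflexive (cong (_·P q) (ℚP.*-comm a c))) (≋-sym (·P-assoc c a q)))

*P-identityˡ : ∀ p → oneP *P p ≋ p
*P-identityˡ p = begin
  (1ℚ ·P p) +P (0ℚ ∷ [])   ≈⟨ +P-cong (·P-identityˡ p) (∷≋[] refl ≋-refl) ⟩
  p +P []                  ≡⟨ +P-identityʳ p ⟩
  p                        ∎
  where open ≋-Reasoning

*P-identityʳ : ∀ p → p *P oneP ≋ p
*P-identityʳ []      = ≋-refl
*P-identityʳ (a ∷ p) = ∷-cong (trans (ℚP.+-identityʳ (a * 1ℚ)) (ℚP.*-identityʳ a)) (*P-identityʳ p)

ev₁ : Poly → ℚ
ev₁ []      = 0ℚ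
ev₁ (c ∷ p) = c + ev₁ p

-- (c + q·p)′(1) = p(1) + p′(1)
deriv₁ : Poly → ℚ
deriv₁ []      = 0ℚ
deriv₁ (c ∷ p) = ev₁ p + deriv₁ p

evalP-1 : ∀ p → evalP 1ℚ p ≡ ev₁ p
evalP-1 []      = refl
evalP-1 (a ∷ p) = cong (λ x → a + x) (trans (ℚP.*-identityˡ _) (evalP-1 p))

ev₁-+P : ∀ p q → ev₁ (p +P q) ≡ ev₁ p + ev₁ q
ev₁-+P []      q       = sym (ℚP.+-identityˡ _)
ev₁-+P (a ∷ p) []      = sym (ℚP.+-identityʳ _)
ev₁-+P (a ∷ p) (b ∷ q) = trans (cong (λ x → (a + b) + x) (ev₁-+P p q)) (+-middle-four a b (ev₁ p) (ev₁ q))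

ev₁-·P : ∀ c p → ev₁ (c ·P p) ≡ c * ev₁ p
ev₁-·P c []      = sym (ℚP.*-zeroʳ c)
ev₁-·P c (a ∷ p) = trans (cong (λ x → c * a + x) (ev₁-·P c p)) (sym (ℚP.*-distribˡ-+ c a (ev₁ p)))

ev₁--P : ∀ p → ev₁ (-P p) ≡ - ev₁ p
ev₁--P []      = refl
ev₁--P (a ∷ p) = trans (cong (λ x → - a + x) (ev₁--P p)) (sym (ℚP.neg-distrib-+ a (ev₁ p)))

ev₁-*P : ∀ p q → ev₁ (p *P q) ≡ ev₁ p * ev₁ q
ev₁-*P []      q = sym (ℚP.*-zeroˡ (ev₁ q))
ev₁-*P (a ∷ p) q = begin
  ev₁ ((a ·P q) +P (0ℚ ∷ (p *P q)))        ≡⟨ ev₁-+P (a ·P q) (0ℚ ∷ (p *P q)) ⟩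
  ev₁ (a ·P q) + (0ℚ + ev₁ (p *P q))       ≡⟨ cong₂ (λ x y → x + (0ℚ + y)) (ev₁-·P a q) (ev₁-*P p q) ⟩
  a * ev₁ q + (0ℚ + ev₁ p * ev₁ q)
    ≡⟨ solve 3 (λ a x y → a :* y :+ (con 0ℚ :+ x :* y) := (a :+ x) :* y) refl a (ev₁ p) (ev₁ q) ⟩
  (a + ev₁ p) * ev₁ q                      ∎
  where open ≡-Reasoning

deriv₁-+P : ∀ p q → deriv₁ (p +P q) ≡ deriv₁ p + deriv₁ q
deriv₁-+P []      q       = sym (ℚP.+-identityˡ _)
deriv₁-+P (a ∷ p) []      = sym (ℚP.+-identityʳ _)
deriv₁-+P (a ∷ p) (b ∷ q) = trans (cong₂ _+_ (ev₁-+P p q) (deriv₁-+P p q)) (+-middle-four (ev₁ p) (ev₁ q) (deriv₁ p) (deriv₁ q))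

deriv₁-·P : ∀ c p → deriv₁ (c ·P p) ≡ c * deriv₁ p
deriv₁-·P c []      = sym (ℚP.*-zeroʳ c)
deriv₁-·P c (a ∷ p) = trans (cong₂ _+_ (ev₁-·P c p) (deriv₁-·P c p)) (sym (ℚP.*-distribˡ-+ c (ev₁ p) (deriv₁ p)))

deriv₁--P : ∀ p → deriv₁ (-P p) ≡ - deriv₁ p
deriv₁--P []      = refl
deriv₁--P (a ∷ p) = trans (cong₂ _+_ (ev₁--P p) (deriv₁--P p)) (sym (ℚP.neg-distrib-+ (ev₁ p) (deriv₁ p)))

deriv₁-*P : ∀ p q → deriv₁ (p *P q) ≡ ev₁ p * deriv₁ q + deriv₁ p * ev₁ q
deriv₁-*P []      q = solve 2 (λ x y → con 0ℚ := con 0ℚ :* x :+ con 0ℚ :* y) refl (deriv₁ q) (ev₁ q)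
deriv₁-*P (a ∷ p) q = begin
  deriv₁ ((a ·P q) +P (0ℚ ∷ (p *P q)))
    ≡⟨ deriv₁-+P (a ·P q) (0ℚ ∷ (p *P q)) ⟩
  deriv₁ (a ·P q) + (ev₁ (p *P q) + deriv₁ (p *P q))
    ≡⟨ cong₂ _+_ (deriv₁-·P a q) (cong₂ _+_ (ev₁-*P p q) (deriv₁-*P p q)) ⟩
  a * deriv₁ q + (ev₁ p * ev₁ q + (ev₁ p * deriv₁ q + deriv₁ p * ev₁ q))
    ≡⟨ solve 5 (λ a x y z w → a :* z :+ (x :* y :+ (x :* z :+ w :* y)) := (a :+ x) :* z :+ (x :+ w) :* y)
         refl a (ev₁ p) (ev₁ q) (deriv₁ q) (deriv₁ p) ⟩
  (a + ev₁ p) * deriv₁ q + (ev₁ p + deriv₁ p) * ev₁ q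
    ∎
  where open ≡-Reasoning

ev₁-≋[] : ∀ {p} → p ≋ [] → ev₁ p ≡ 0ℚ
ev₁-≋[] {[]}    p≋0 = refl
ev₁-≋[] {a ∷ p} p≋0 with ∷≋[]⁻¹ p≋0
... | a≡0 , p′≋0 = cong₂ _+_ a≡0 (ev₁-≋[] p′≋0)

deriv₁-≋[] : ∀ {p} → p ≋ [] → deriv₁ p ≡ 0ℚ
deriv₁-≋[] {[]}    p≋0 = refl
deriv₁-≋[] {a ∷ p} p≋0 with ∷≋[]⁻¹ p≋0
... | _ , p′≋0 = cong₂ _+_ (ev₁-≋[] p′≋0) (deriv₁-≋[] p′≋0)

ev₁-cong : ∀ {p q} → p ≋ q → ev₁ p ≡ ev₁ q
ev₁-cong {[]}    {q}     p≋q     = sym (ev₁-≋[] (≋-sym p≋q))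
ev₁-cong {a ∷ p} {[]}    p≋q     = ev₁-≋[] p≋q
ev₁-cong {a ∷ p} {b ∷ q} (mk≋ e) = cong₂ _+_ (e zero) (ev₁-cong {p} {q} (mk≋ λ i → e (suc i)))

deriv₁-cong : ∀ {p q} → p ≋ q → deriv₁ p ≡ deriv₁ q
deriv₁-cong {[]}    {q}     p≋q     = sym (deriv₁-≋[] (≋-sym p≋q))
deriv₁-cong {a ∷ p} {[]}    p≋q     = deriv₁-≋[] p≋q
deriv₁-cong {a ∷ p} {b ∷ q} (mk≋ e) = cong₂ _+_ (ev₁-cong tail≋) (deriv₁-cong tail≋)
  where
  tail≋ : p ≋ q
  tail≋ = mk≋ λ i → e (suc i)

-- how the limit q → 1 of a quotient by 1 - q is taken
deriv₁-oneMinusQ-*P : ∀ D → deriv₁ (oneMinusQ *P D) ≡ - ev₁ D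
deriv₁-oneMinusQ-*P D = begin
  deriv₁ (oneMinusQ *P D)
    ≡⟨ deriv₁-*P oneMinusQ D ⟩
  ev₁ oneMinusQ * deriv₁ D + deriv₁ oneMinusQ * ev₁ D
    ≡⟨⟩
  0ℚ * deriv₁ D + (- 1ℚ) * ev₁ D
    ≡⟨ solve 2 (λ d v → con 0ℚ :* d :+ (:- con 1ℚ) :* v := :- v) refl (deriv₁ D) (ev₁ D) ⟩
  - ev₁ D                                               ∎
  where open ≡-Reasoning

coeffP-oneMinusQ-*P-zero : ∀ p → coeffP zero (oneMinusQ *P p) ≡ coeffP zero p
coeffP-oneMinusQ-*P-zero p = trans (coeffP-*P-zero 1ℚ ((- 1ℚ) ∷ []) p) (ℚP.*-identityˡ (coeffP zero p))

coeffP-oneMinusQ-*P-suc : ∀ i p → coeffP (suc i) (oneMinusQ *P p) ≡ coeffP (suc i) p - coeffP i p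
coeffP-oneMinusQ-*P-suc i p = begin
  coeffP (suc i) (oneMinusQ *P p)
    ≡⟨ coeffP-*P-suc i 1ℚ ((- 1ℚ) ∷ []) p ⟩
  1ℚ * coeffP (suc i) p + coeffP i (((- 1ℚ) ∷ []) *P p)
    ≡⟨ cong (λ x → 1ℚ * coeffP (suc i) p + x) minus ⟩
  1ℚ * coeffP (suc i) p + (- 1ℚ * coeffP i p + 0ℚ)
    ≡⟨ solve 2 (λ x y → con 1ℚ :* x :+ ((:- con 1ℚ) :* y :+ con 0ℚ) := x :+ (:- y)) refl (coeffP (suc i) p) (coeffP i p) ⟩
  coeffP (suc i) p - coeffP i p                                    ∎
  where
  open ≡-Reasoning
  minus : coeffP i (((- 1ℚ) ∷ []) *P p) ≡ - 1ℚ * coeffP i p + 0ℚ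
  minus = trans (coeffP-+P i ((- 1ℚ) ·P p) (0ℚ ∷ [])) (cong₂ _+_ (coeffP-·P i (- 1ℚ) p) (coeff≡ (∷≋[] refl ≋-refl) i))

private
  length-+P-singleton : ∀ {f} p x → length p ≤ suc f → length (p +P (x ∷ [])) ≤ suc f
  length-+P-singleton []          x _ = s≤s z≤n
  length-+P-singleton (a ∷ [])    x h = h
  length-+P-singleton (a ∷ b ∷ p) x h = h

-- long division: the quotient of c + q·p by 1 - q is c + q·(p + c)/(1 - q)
divS-oneMinusQ : ∀ f p → length p ≤ suc f → ev₁ p ≡ 0ℚ → oneMinusQ *P divS f p ((- 1ℚ) ∷ []) ≋ p
divS-oneMinusQ zero    []          _         _    = *P-zeroʳ oneMinusQ
divS-oneMinusQ zero    (c ∷ [])    _         p1≡0 =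
  ≋-trans (*P-zeroʳ oneMinusQ) (≋-sym (∷≋[] (trans (sym (ℚP.+-identityʳ c)) p1≡0) ≋-refl))
divS-oneMinusQ zero    (c ∷ _ ∷ _) (s≤s ())  _
divS-oneMinusQ (suc f) []          _         _    = *P-zeroʳ oneMinusQ
divS-oneMinusQ (suc f) (c ∷ p)     (s≤s len) p1≡0 = mk≋ λ
  { zero          → coeffP-oneMinusQ-*P-zero (c ∷ D)
  ; (suc zero)    → begin
      coeffP 1 (oneMinusQ *P (c ∷ D))        ≡⟨ coeffP-oneMinusQ-*P-suc zero (c ∷ D) ⟩
      coeffP 0 D - c                         ≡⟨ cong (_- c) (sym (coeffP-oneMinusQ-*P-zero D)) ⟩
      coeffP 0 (oneMinusQ *P D) - c          ≡⟨ cong (_- c) (trans (coeff≡ quotient zero) (coeffP-+P zero p (c′ ∷ []))) ⟩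
      (coeffP 0 p + c′) - c                  ≡⟨ cong (λ x → (coeffP 0 p + x) - c) c′≡c ⟩
      (coeffP 0 p + c) - c                   ≡⟨ solve 2 (λ y c → (y :+ c) :+ (:- c) := y) refl (coeffP 0 p) c ⟩
      coeffP 0 p                             ∎
  ; (suc (suc j)) → begin
      coeffP (2 ℕ.+ j) (oneMinusQ *P (c ∷ D))  ≡⟨ coeffP-oneMinusQ-*P-suc (suc j) (c ∷ D) ⟩
      coeffP (suc j) D - coeffP j D            ≡⟨ coeffP-oneMinusQ-*P-suc j D ⟨
      coeffP (suc j) (oneMinusQ *P D)          ≡⟨ coeff≡ quotient (suc j) ⟩
      coeffP (suc j) (p +P (c′ ∷ []))          ≡⟨ coeffP-+P (suc j) p (c′ ∷ []) ⟩
      coeffP (suc j) p + 0ℚ                    ≡⟨ ℚP.+-identityʳ _ ⟩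
      coeffP (suc j) p                         ∎
  }
  where
  open ≡-Reasoning
  c′ : ℚ
  c′ = - (c * - 1ℚ)
  c′≡c : c′ ≡ c
  c′≡c = solve 1 (λ c → :- (c :* (:- con 1ℚ)) := c) refl c
  D : Poly
  D = divS f (p +P (c′ ∷ [])) ((- 1ℚ) ∷ [])
  quotient : oneMinusQ *P D ≋ p +P (c′ ∷ [])
  quotient = divS-oneMinusQ f (p +P (c′ ∷ [])) (length-+P-singleton p c′ len) (begin
    ev₁ (p +P (c′ ∷ []))     ≡⟨ ev₁-+P p (c′ ∷ []) ⟩
    ev₁ p + (c′ + 0ℚ)        ≡⟨ cong (λ x → ev₁ p + x) (trans (ℚP.+-identityʳ c′) c′≡c) ⟩
    ev₁ p + c                ≡⟨ ℚP.+-comm (ev₁ p) c ⟩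
    c + ev₁ p                ≡⟨ p1≡0 ⟩
    0ℚ                       ∎)

divOneMinusQ-correct : ∀ p → ev₁ p ≡ 0ℚ → oneMinusQ *P divOneMinusQ p ≋ p
divOneMinusQ-correct p = divS-oneMinusQ (length p) p (ℕP.n≤1+n (length p))

ev₁-qint : ∀ k → ev₁ (qint k) ≡ fromℕℚ k
ev₁-qint zero    = refl
ev₁-qint (suc k) = trans (cong (λ x → 1ℚ + x) (ev₁-qint k)) (sym (fromℕℚ-+ 1 k))

ev₁-qfact : ∀ n → ev₁ (qfact n) ≡ fromℕℚ (n !)
ev₁-qfact zero    = refl
ev₁-qfact (suc n) = begin
  ev₁ (qint (suc n) *P qfact n)           ≡⟨ ev₁-*P (qint (suc n)) (qfact n) ⟩
  ev₁ (qint (suc n)) * ev₁ (qfact n)      ≡⟨ cong₂ _*_ (ev₁-qint (suc n)) (ev₁-qfact n) ⟩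
  fromℕℚ (suc n) * fromℕℚ (n !)           ≡⟨ fromℕℚ-* (suc n) (n !) ⟨
  fromℕℚ (suc n !)                        ∎
  where open ≡-Reasoning

ev₁-^P : ∀ {p m} n → ev₁ p ≡ fromℕℚ m → ev₁ (p ^P n) ≡ fromℕℚ (m ^ n)
ev₁-^P {p} {m} zero    p1≡m = refl
ev₁-^P {p} {m} (suc n) p1≡m = begin
  ev₁ (p *P (p ^P n))           ≡⟨ ev₁-*P p (p ^P n) ⟩
  ev₁ p * ev₁ (p ^P n)          ≡⟨ cong₂ _*_ p1≡m (ev₁-^P n p1≡m) ⟩
  fromℕℚ m * fromℕℚ (m ^ n)     ≡⟨ fromℕℚ-* m (m ^ n) ⟨
  fromℕℚ (m ^ suc n)            ∎
  where open ≡-Reasoning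

-- p′(1) / p(1) = t / c, stated without division
record LogDerivative₁ (c : ℚ) (p : Poly) (t : ℚ) : Set where
  constructor logDerivative₁
  field c*deriv₁≡ev₁*t : c * deriv₁ p ≡ ev₁ p * t
open LogDerivative₁

logDerivative₁-·P : ∀ {c p t} r → LogDerivative₁ c p t → LogDerivative₁ c (r ·P p) t
logDerivative₁-·P {c} {p} {t} r (logDerivative₁ hyp) = logDerivative₁ (begin
  c * deriv₁ (r ·P p)      ≡⟨ cong (c *_) (deriv₁-·P r p) ⟩
  c * (r * deriv₁ p)       ≡⟨ solve 3 (λ c r d → c :* (r :* d) := r :* (c :* d)) refl c r (deriv₁ p) ⟩
  r * (c * deriv₁ p)       ≡⟨ cong (r *_) hyp ⟩
  r * (ev₁ p * t)          ≡⟨ ℚP.*-assoc r (ev₁ p) t ⟨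
  r * ev₁ p * t            ≡⟨ cong (_* t) (ev₁-·P r p) ⟨
  ev₁ (r ·P p) * t         ∎)
  where open ≡-Reasoning

logDerivative₁-*P : ∀ {c p q s t} → LogDerivative₁ c p s → LogDerivative₁ c q t → LogDerivative₁ c (p *P q) (s + t)
logDerivative₁-*P {c} {p} {q} {s} {t} (logDerivative₁ hyp-p) (logDerivative₁ hyp-q) = logDerivative₁ (begin
  c * deriv₁ (p *P q)
    ≡⟨ cong (c *_) (deriv₁-*P p q) ⟩
  c * (ev₁ p * deriv₁ q + deriv₁ p * ev₁ q)
    ≡⟨ solve 5 (λ c u dq dp w → c :* (u :* dq :+ dp :* w) := u :* (c :* dq) :+ (c :* dp) :* w)
               refl c (ev₁ p) (deriv₁ q) (deriv₁ p) (ev₁ q) ⟩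
  ev₁ p * (c * deriv₁ q) + (c * deriv₁ p) * ev₁ q
    ≡⟨ cong₂ (λ x y → ev₁ p * x + y * ev₁ q) hyp-q hyp-p ⟩
  ev₁ p * (ev₁ q * t) + (ev₁ p * s) * ev₁ q
    ≡⟨ solve 4 (λ u w s t → u :* (w :* t) :+ (u :* s) :* w := (u :* w) :* (s :+ t)) refl (ev₁ p) (ev₁ q) s t ⟩
  (ev₁ p * ev₁ q) * (s + t)
    ≡⟨ cong (_* (s + t)) (ev₁-*P p q) ⟨
  ev₁ (p *P q) * (s + t)                              ∎)
  where open ≡-Reasoning

logDerivative₁-^P : ∀ {c p t} n → LogDerivative₁ c p t → LogDerivative₁ c (p ^P n) (fromℕℚ n * t)
logDerivative₁-^P {c} {p} {t} zero    hyp =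
  logDerivative₁ (solve 2 (λ c t → c :* con 0ℚ := (con 1ℚ :+ con 0ℚ) :* (con 0ℚ :* t)) refl c t)
logDerivative₁-^P {c} {p} {t} (suc n) hyp = subst (LogDerivative₁ c (p ^P suc n)) t+nt≡[1+n]t
  (logDerivative₁-*P hyp (logDerivative₁-^P n hyp))
  where
  t+nt≡[1+n]t : t + fromℕℚ n * t ≡ fromℕℚ (suc n) * t
  t+nt≡[1+n]t = trans (solve 2 (λ t m → t :+ m :* t := (con 1ℚ :+ m) :* t) refl t (fromℕℚ n)) (cong (_* t) (sym (fromℕℚ-+ 1 n)))

logDerivative₁-qint : ∀ k → LogDerivative₁ (fromℕℚ 4) (qint k) (fromℕℚ 2 * (fromℕℚ k - 1ℚ))
logDerivative₁-qint zero    = logDerivative₁ refl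
logDerivative₁-qint (suc k) = logDerivative₁ (begin
  fromℕℚ 4 * (ev₁ (qint k) + deriv₁ (qint k))
    ≡⟨ ℚP.*-distribˡ-+ (fromℕℚ 4) (ev₁ (qint k)) (deriv₁ (qint k)) ⟩
  fromℕℚ 4 * ev₁ (qint k) + fromℕℚ 4 * deriv₁ (qint k)
    ≡⟨ cong (λ x → fromℕℚ 4 * ev₁ (qint k) + x) (c*deriv₁≡ev₁*t (logDerivative₁-qint k)) ⟩
  fromℕℚ 4 * ev₁ (qint k) + ev₁ (qint k) * (fromℕℚ 2 * (K - 1ℚ))
    ≡⟨ cong (λ v → fromℕℚ 4 * v + v * (fromℕℚ 2 * (K - 1ℚ))) (ev₁-qint k) ⟩
  fromℕℚ 4 * K + K * (fromℕℚ 2 * (K - 1ℚ))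
    ≡⟨ solve 1 (λ K → con (fromℕℚ 4) :* K :+ K :* (con (fromℕℚ 2) :* (K :+ (:- con 1ℚ)))
                   := (con 1ℚ :+ K) :* (con (fromℕℚ 2) :* ((con 1ℚ :+ K) :+ (:- con 1ℚ)))) refl K ⟩
  (1ℚ + K) * (fromℕℚ 2 * ((1ℚ + K) - 1ℚ))
    ≡⟨ cong₂ (λ v k′ → v * (fromℕℚ 2 * (k′ - 1ℚ))) (cong (λ x → 1ℚ + x) (sym (ev₁-qint k))) (sym (fromℕℚ-+ 1 k)) ⟩
  (1ℚ + ev₁ (qint k)) * (fromℕℚ 2 * (fromℕℚ (suc k) - 1ℚ))        ∎)
  where
  open ≡-Reasoning
  K : ℚ
  K = fromℕℚ k

orderedPairs : ℕ → ℚ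
orderedPairs n = fromℕℚ n * (fromℕℚ n - 1ℚ)

logDerivative₁-qfact : ∀ n → LogDerivative₁ (fromℕℚ 4) (qfact n) (orderedPairs n)
logDerivative₁-qfact zero    = logDerivative₁ refl
logDerivative₁-qfact (suc n) = subst (LogDerivative₁ (fromℕℚ 4) (qfact (suc n))) sum≡
  (logDerivative₁-*P (logDerivative₁-qint (suc n)) (logDerivative₁-qfact n))
  where
  sum≡ : fromℕℚ 2 * (fromℕℚ (suc n) - 1ℚ) + orderedPairs n ≡ orderedPairs (suc n)
  sum≡ = trans (cong (λ m → fromℕℚ 2 * (m - 1ℚ) + fromℕℚ n * (fromℕℚ n - 1ℚ)) (fromℕℚ-+ 1 n))
    (trans (solve 1 (λ m → con (fromℕℚ 2) :* ((con 1ℚ :+ m) :+ (:- con 1ℚ)) :+ m :* (m :+ (:- con 1ℚ))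
                           := (con 1ℚ :+ m) :* ((con 1ℚ :+ m) :+ (:- con 1ℚ))) refl (fromℕℚ n))
           (cong (λ m → m * (m - 1ℚ)) (sym (fromℕℚ-+ 1 n))))

recipℕ-·P-^P : ∀ m .{{_ : NonZero m}} p n → (recipℕ m ·P p) ^P n ≋ recipℕ (m ^ n) ·P (p ^P n)
recipℕ-·P-^P m p zero    = ≋-sym (·P-identityˡ oneP)
recipℕ-·P-^P m p (suc n) = begin
  (recipℕ m ·P p) *P ((recipℕ m ·P p) ^P n)          ≈⟨ *P-congʳ (recipℕ m ·P p) (recipℕ-·P-^P m p n) ⟩
  (recipℕ m ·P p) *P (recipℕ (m ^ n) ·P (p ^P n))    ≈⟨ ·P-*P-assoc (recipℕ m) p _ ⟩
  recipℕ m ·P (p *P (recipℕ (m ^ n) ·P (p ^P n)))    ≈⟨ ·P-congʳ (recipℕ m) (*P-·P-comm (recipℕ (m ^ n)) p (p ^P n)) ⟩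
  recipℕ m ·P (recipℕ (m ^ n) ·P (p ^P suc n))       ≈⟨ ·P-assoc (recipℕ m) (recipℕ (m ^ n)) (p ^P suc n) ⟩
  (recipℕ m * recipℕ (m ^ n)) ·P (p ^P suc n)        ≡⟨ cong (_·P (p ^P suc n)) (sym (recipℕ-* m (m ^ n))) ⟩
  recipℕ (m ^ suc n) ·P (p ^P suc n)                 ∎
  where
  open ≋-Reasoning
  instance
    m^n≢0 : NonZero (m ^ n)
    m^n≢0 = ℕP.m^n≢0 m n

-- the coefficient of p_1^{ab} in H_b[H_a]
plethCoeff : ℕ → ℕ → Poly
plethCoeff a b = recipℕ (b ! ℕ.* ((a !) ^ b)) ·P (qfact b *P (qfact a ^P b))

module _ (a b : ℕ) where
  private instance
    a!≢0 : NonZero (a !)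
    a!≢0 = a !≢0
    b!≢0 : NonZero (b !)
    b!≢0 = b !≢0
    a!^b≢0 : NonZero ((a !) ^ b)
    a!^b≢0 = ℕP.m^n≢0 (a !) b
    b!a!^b≢0 : NonZero (b ! ℕ.* (a !) ^ b)
    b!a!^b≢0 = ℕP.m*n≢0 (b !) ((a !) ^ b)

  plethCoeff-factorisation : (recipℕ (b !) ·P qfact b) *P ((recipℕ (a !) ·P qfact a) ^P b) ≋ plethCoeff a b
  plethCoeff-factorisation = begin
    (recipℕ (b !) ·P qfact b) *P ((recipℕ (a !) ·P qfact a) ^P b)
      ≈⟨ *P-congʳ (recipℕ (b !) ·P qfact b) (recipℕ-·P-^P (a !) (qfact a) b) ⟩
    (recipℕ (b !) ·P qfact b) *P (recipℕ ((a !) ^ b) ·P (qfact a ^P b))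
      ≈⟨ ·P-*P-assoc (recipℕ (b !)) (qfact b) (recipℕ ((a !) ^ b) ·P (qfact a ^P b)) ⟩
    recipℕ (b !) ·P (qfact b *P (recipℕ ((a !) ^ b) ·P (qfact a ^P b)))
      ≈⟨ ·P-congʳ (recipℕ (b !)) (*P-·P-comm (recipℕ ((a !) ^ b)) (qfact b) (qfact a ^P b)) ⟩
    recipℕ (b !) ·P (recipℕ ((a !) ^ b) ·P (qfact b *P (qfact a ^P b)))
      ≈⟨ ·P-assoc (recipℕ (b !)) (recipℕ ((a !) ^ b)) _ ⟩
    (recipℕ (b !) * recipℕ ((a !) ^ b)) ·P (qfact b *P (qfact a ^P b))
      ≡⟨ cong (_·P (qfact b *P (qfact a ^P b))) (sym (recipℕ-* (b !) ((a !) ^ b))) ⟩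
    plethCoeff a b                                                        ∎
    where open ≋-Reasoning

  ev₁-plethCoeff : ev₁ (plethCoeff a b) ≡ 1ℚ
  ev₁-plethCoeff = begin
    ev₁ (r ·P (qfact b *P (qfact a ^P b)))         ≡⟨ ev₁-·P r (qfact b *P (qfact a ^P b)) ⟩
    r * ev₁ (qfact b *P (qfact a ^P b))            ≡⟨ cong (r *_) (ev₁-*P (qfact b) (qfact a ^P b)) ⟩
    r * (ev₁ (qfact b) * ev₁ (qfact a ^P b))       ≡⟨ cong (r *_) (cong₂ _*_ (ev₁-qfact b) (ev₁-^P b (ev₁-qfact a))) ⟩
    r * (fromℕℚ (b !) * fromℕℚ ((a !) ^ b))        ≡⟨ cong (r *_) (fromℕℚ-* (b !) ((a !) ^ b)) ⟨
    r * fromℕℚ (b ! ℕ.* (a !) ^ b)                 ≡⟨ recipℕ-inverse (b ! ℕ.* (a !) ^ b) ⟩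
    1ℚ                                             ∎
    where
    open ≡-Reasoning
    r : ℚ
    r = recipℕ (b ! ℕ.* ((a !) ^ b))

deriv₁-plethCoeff : ∀ a b → fromℕℚ 4 * deriv₁ (plethCoeff a b) ≡ orderedPairs b + fromℕℚ b * orderedPairs a
deriv₁-plethCoeff a b = trans (c*deriv₁≡ev₁*t slope) (trans (cong (_* t) (ev₁-plethCoeff a b)) (ℚP.*-identityˡ t))
  where
  t : ℚ
  t = orderedPairs b + fromℕℚ b * orderedPairs a
  slope : LogDerivative₁ (fromℕℚ 4) (plethCoeff a b) t
  slope = logDerivative₁-·P (recipℕ (b ! ℕ.* ((a !) ^ b)))
            (logDerivative₁-*P (logDerivative₁-qfact b) (logDerivative₁-^P b (logDerivative₁-qfact a)))

ones : ℕ → List ℕ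
ones n = replicate n 1

allOnes : List ℕ → Bool
allOnes []      = true
allOnes (k ∷ l) = (k ℕ.≡ᵇ 1) ∧ allOnes l

allOnes-ones : ∀ n → allOnes (ones n) ≡ true
allOnes-ones zero    = refl
allOnes-ones (suc n) = allOnes-ones n

sumℕ-ones : ∀ n → sumℕ (ones n) ≡ n
sumℕ-ones zero    = refl
sumℕ-ones (suc n) = cong suc (sumℕ-ones n)

allOnes⇒≡ones : ∀ l → allOnes l ≡ true → l ≡ ones (sumℕ l)
allOnes⇒≡ones []                  _   = refl
allOnes⇒≡ones (suc zero ∷ l)      all1 = cong (1 ∷_) (allOnes⇒≡ones l all1)
allOnes⇒≡ones (zero ∷ l)          ()
allOnes⇒≡ones (suc (suc k) ∷ l)   ()

allOnes-++ : ∀ l m → allOnes (l ++ m) ≡ allOnes l ∧ allOnes m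
allOnes-++ []      m = refl
allOnes-++ (k ∷ l) m = trans (cong ((k ℕ.≡ᵇ 1) ∧_) (allOnes-++ l m)) (sym (BoolP.∧-assoc (k ℕ.≡ᵇ 1) (allOnes l) (allOnes m)))

allOnes-insertD : ∀ k l → allOnes (insertD k l) ≡ (k ℕ.≡ᵇ 1) ∧ allOnes l
allOnes-insertD k []      = refl
allOnes-insertD k (j ∷ l) with k ℕ.≥? j
... | yes _ = refl
... | no  _ = trans (cong ((j ℕ.≡ᵇ 1) ∧_) (allOnes-insertD k l)) (∧-swap (j ℕ.≡ᵇ 1) (k ℕ.≡ᵇ 1) (allOnes l))
  where
  ∧-swap : ∀ x y z → x ∧ (y ∧ z) ≡ y ∧ (x ∧ z)
  ∧-swap x y z = trans (sym (BoolP.∧-assoc x y z)) (trans (cong (_∧ z) (BoolP.∧-comm x y)) (BoolP.∧-assoc y x z))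

allOnes-sortD : ∀ l → allOnes (sortD l) ≡ allOnes l
allOnes-sortD []      = refl
allOnes-sortD (k ∷ l) = trans (allOnes-insertD k (sortD l)) (cong ((k ℕ.≡ᵇ 1) ∧_) (allOnes-sortD l))

sumℕ-insertD : ∀ k l → sumℕ (insertD k l) ≡ k ℕ.+ sumℕ l
sumℕ-insertD k []      = refl
sumℕ-insertD k (j ∷ l) with k ℕ.≥? j
... | yes _ = refl
... | no  _ = trans (cong (j ℕ.+_) (sumℕ-insertD k l)) (+-left-comm j k (sumℕ l))

sumℕ-sortD : ∀ l → sumℕ (sortD l) ≡ sumℕ l
sumℕ-sortD []      = refl
sumℕ-sortD (k ∷ l) = trans (sumℕ-insertD k (sortD l)) (cong (k ℕ.+_) (sumℕ-sortD l))

sumℕ-sortD-++ : ∀ l m → sumℕ (sortD (l ++ m)) ≡ sumℕ l ℕ.+ sumℕ m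
sumℕ-sortD-++ l m = trans (sumℕ-sortD (l ++ m)) (ListActionP.sum-++ l m)

sortD-ones-++-ones : ∀ m k → sortD (ones m ++ ones k) ≡ ones (m ℕ.+ k)
sortD-ones-++-ones m k = begin
  sortD (ones m ++ ones k)
    ≡⟨ allOnes⇒≡ones _ all1 ⟩
  ones (sumℕ (sortD (ones m ++ ones k)))
    ≡⟨ cong ones (trans (sumℕ-sortD-++ (ones m) (ones k)) (cong₂ ℕ._+_ (sumℕ-ones m) (sumℕ-ones k))) ⟩
  ones (m ℕ.+ k)                                ∎
  where
  open ≡-Reasoning
  all1 : allOnes (sortD (ones m ++ ones k)) ≡ true
  all1 = trans (allOnes-sortD (ones m ++ ones k)) (trans (allOnes-++ (ones m) (ones k)) (cong₂ _∧_ (allOnes-ones m) (allOnes-ones k)))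

sortD-++≡ones⁻¹ : ∀ {m k} μ l → sumℕ μ ≡ m → sumℕ l ≡ k →
  sortD (μ ++ l) ≡ ones (m ℕ.+ k) → (μ ≡ ones m) × (l ≡ ones k)
sortD-++≡ones⁻¹ μ l refl refl sorted≡ones =
  allOnes⇒≡ones μ (BoolP.∧-conicalˡ _ _ both) , allOnes⇒≡ones l (BoolP.∧-conicalʳ _ _ both)
  where
  both : allOnes μ ∧ allOnes l ≡ true
  both = trans (sym (allOnes-++ μ l)) (trans (sym (allOnes-sortD (μ ++ l)))
    (trans (cong allOnes sorted≡ones) (allOnes-ones (sumℕ μ ℕ.+ sumℕ l))))

sumP : List Poly → Poly
sumP = foldr _+P_ []

sumP-++ : ∀ ps qs → sumP (ps ++ qs) ≋ sumP ps +P sumP qs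
sumP-++ []       qs = ≋-refl
sumP-++ (p ∷ ps) qs = ≋-trans (+P-congʳ p (sumP-++ ps qs)) (≋-sym (+P-assoc p (sumP ps) (sumP qs)))

sumP-map-cong : ∀ {A : Set} {F G : A → Poly} xs → (∀ x → F x ≋ G x) → sumP (map F xs) ≋ sumP (map G xs)
sumP-map-cong []       F≋G = ≋-refl
sumP-map-cong (x ∷ xs) F≋G = +P-cong (F≋G x) (sumP-map-cong xs F≋G)

sumP-map-≋[] : ∀ {A : Set} (F : A → Poly) {xs} → All (λ x → F x ≋ []) xs → sumP (map F xs) ≋ []
sumP-map-≋[] F []           = ≋-refl
sumP-map-≋[] F (Fx≋0 ∷ all) = +P-cong Fx≋0 (sumP-map-≋[] F all)

coeffSym-++ : ∀ μ f g → coeffSym μ (f ++ g) ≋ coeffSym μ f +P coeffSym μ g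
coeffSym-++ μ []            g = ≋-refl
coeffSym-++ μ ((c , λ′) ∷ f) g with ≡-dec ℕ._≟_ μ λ′
... | yes _ = ≋-trans (+P-congʳ c (coeffSym-++ μ f g)) (≋-sym (+P-assoc c (coeffSym μ f) (coeffSym μ g)))
... | no  _ = coeffSym-++ μ f g

coeffSym-negSym : ∀ μ f → coeffSym μ (negSym f) ≋ -P coeffSym μ f
coeffSym-negSym μ []             = ≋-refl
coeffSym-negSym μ ((c , λ′) ∷ f) with ≡-dec ℕ._≟_ μ λ′
... | yes _ = ≋-trans (+P-congʳ (-P c) (coeffSym-negSym μ f)) (≋-sym (-P-distrib-+P c (coeffSym μ f)))
... | no  _ = coeffSym-negSym μ f

coeffSym--Sym : ∀ μ f g → coeffSym μ (f -Sym g) ≋ coeffSym μ f -P coeffSym μ g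
coeffSym--Sym μ f g = ≋-trans (coeffSym-++ μ f (negSym g)) (+P-congʳ (coeffSym μ f) (coeffSym-negSym μ g))

coeffSym-scale : ∀ μ c f → coeffSym μ (map (λ e → (c *P proj₁ e , proj₂ e)) f) ≋ c *P coeffSym μ f
coeffSym-scale μ c []             = ≋-sym (*P-zeroʳ c)
coeffSym-scale μ c ((d , λ′) ∷ f) with ≡-dec ℕ._≟_ μ λ′
... | yes _ = ≋-trans (+P-congʳ (c *P d) (coeffSym-scale μ c f)) (≋-sym (*P-distribˡ c d (coeffSym μ f)))
... | no  _ = coeffSym-scale μ c f

coeffSym-concatMap : ∀ {A : Set} μ (h : A → SymP) xs → coeffSym μ (concatMap h xs) ≋ sumP (map (λ x → coeffSym μ (h x)) xs)
coeffSym-concatMap μ h []       = ≋-refl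
coeffSym-concatMap μ h (x ∷ xs) = ≋-trans (coeffSym-++ μ (h x) (concatMap h xs)) (+P-congʳ (coeffSym μ (h x)) (coeffSym-concatMap μ h xs))

select : List ℕ → List ℕ → Poly → Poly
select μ λ′ p with ≡-dec ℕ._≟_ μ λ′
... | yes _ = p
... | no  _ = []

select-≢ : ∀ {μ λ′} p → μ ≢ λ′ → select μ λ′ p ≡ []
select-≢ {μ} {λ′} p μ≢λ′ with ≡-dec ℕ._≟_ μ λ′
... | yes μ≡λ′ = ⊥-elim (μ≢λ′ μ≡λ′)
... | no  _    = refl

select-refl : ∀ μ p → select μ μ p ≡ p
select-refl μ p with ≡-dec ℕ._≟_ μ μ
... | yes _  = refl
... | no μ≢μ = ⊥-elim (μ≢μ refl)

coeffSym-tabulate : ∀ μ (h : List ℕ → Poly) λs →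
  coeffSym μ (map (λ λ′ → (h λ′ , λ′)) λs) ≋ sumP (map (λ λ′ → select μ λ′ (h λ′)) λs)
coeffSym-tabulate μ h []        = ≋-refl
coeffSym-tabulate μ h (λ′ ∷ λs) with ≡-dec ℕ._≟_ μ λ′
... | yes _ = +P-congʳ (h λ′) (coeffSym-tabulate μ h λs)
... | no  _ = coeffSym-tabulate μ h λs

Homogeneous : ℕ → SymP → Set
Homogeneous m f = All (λ e → sumℕ (proj₂ e) ≡ m) f

mulTerm : Poly → List ℕ → SymP → SymP
mulTerm c μ g = map (λ e → (c *P proj₁ e , sortD (μ ++ proj₂ e))) g

homogeneous-mulTerm : ∀ {m k} c μ g → sumℕ μ ≡ m → Homogeneous k g → Homogeneous (m ℕ.+ k) (mulTerm c μ g)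
homogeneous-mulTerm c μ []            _    []            = []
homogeneous-mulTerm c μ ((d , λ′) ∷ g) refl (refl ∷ homg) = sumℕ-sortD-++ μ λ′ ∷ homogeneous-mulTerm c μ g refl homg

homogeneous-mulSym : ∀ {m k} f g → Homogeneous m f → Homogeneous k g → Homogeneous (m ℕ.+ k) (mulSym f g)
homogeneous-mulSym []            g []           homg = []
homogeneous-mulSym ((c , μ) ∷ f) g (sμ ∷ homf) homg = AllP.++⁺ (homogeneous-mulTerm c μ g sμ homg) (homogeneous-mulSym f g homf homg)

coeffSym-mulTerm-ones : ∀ m {k} c g → Homogeneous k g → coeffSym (ones (m ℕ.+ k)) (mulTerm c (ones m) g) ≋ c *P coeffSym (ones k) g
coeffSym-mulTerm-ones m c []             [] = ≋-sym (*P-zeroʳ c)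
coeffSym-mulTerm-ones m {k} c ((d , λ′) ∷ g) (sλ′ ∷ homg)
  with ≡-dec ℕ._≟_ (ones (m ℕ.+ k)) (sortD (ones m ++ λ′)) | ≡-dec ℕ._≟_ (ones k) λ′
... | yes _  | yes _  = ≋-trans (+P-congʳ (c *P d) (coeffSym-mulTerm-ones m c g homg)) (≋-sym (*P-distribˡ c d (coeffSym (ones k) g)))
... | yes eq | no  ne = ⊥-elim (ne (sym (proj₂ (sortD-++≡ones⁻¹ (ones m) λ′ (sumℕ-ones m) sλ′ (sym eq)))))
... | no  ne | yes refl = ⊥-elim (ne (sym (sortD-ones-++-ones m k)))
... | no  _  | no  _  = coeffSym-mulTerm-ones m c g homg

coeffSym-mulTerm-≢ones : ∀ {m k} c μ g → sumℕ μ ≡ m → Homogeneous k g → ones m ≢ μ →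
  coeffSym (ones (m ℕ.+ k)) (mulTerm c μ g) ≡ []
coeffSym-mulTerm-≢ones         c μ []             _  []           _  = refl
coeffSym-mulTerm-≢ones {m} {k} c μ ((d , λ′) ∷ g) sμ (sλ′ ∷ homg) ne with ≡-dec ℕ._≟_ (ones (m ℕ.+ k)) (sortD (μ ++ λ′))
... | yes eq = ⊥-elim (ne (sym (proj₁ (sortD-++≡ones⁻¹ μ λ′ sμ sλ′ (sym eq)))))
... | no  _  = coeffSym-mulTerm-≢ones c μ g sμ homg ne

coeffSym-mulSym-ones : ∀ m k f g → Homogeneous m f → Homogeneous k g →
  coeffSym (ones (m ℕ.+ k)) (mulSym f g) ≋ coeffSym (ones m) f *P coeffSym (ones k) g
coeffSym-mulSym-ones m k []            g []          homg = ≋-refl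
coeffSym-mulSym-ones m k ((c , μ) ∷ f) g (sμ ∷ homf) homg with ≡-dec ℕ._≟_ (ones m) μ
... | yes refl = begin
  coeffSym (ones (m ℕ.+ k)) (mulTerm c (ones m) g ++ mulSym f g)
    ≈⟨ coeffSym-++ (ones (m ℕ.+ k)) (mulTerm c (ones m) g) (mulSym f g) ⟩
  coeffSym (ones (m ℕ.+ k)) (mulTerm c (ones m) g) +P coeffSym (ones (m ℕ.+ k)) (mulSym f g)
    ≈⟨ +P-cong (coeffSym-mulTerm-ones m c g homg) (coeffSym-mulSym-ones m k f g homf homg) ⟩
  (c *P coeffSym (ones k) g) +P (coeffSym (ones m) f *P coeffSym (ones k) g)
    ≈⟨ *P-distribʳ c (coeffSym (ones m) f) (coeffSym (ones k) g) ⟨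
  (c +P coeffSym (ones m) f) *P coeffSym (ones k) g
    ∎
  where open ≋-Reasoning
... | no ne = begin
  coeffSym (ones (m ℕ.+ k)) (mulTerm c μ g ++ mulSym f g)
    ≈⟨ coeffSym-++ (ones (m ℕ.+ k)) (mulTerm c μ g) (mulSym f g) ⟩
  coeffSym (ones (m ℕ.+ k)) (mulTerm c μ g) +P coeffSym (ones (m ℕ.+ k)) (mulSym f g)
    ≡⟨ cong (_+P coeffSym (ones (m ℕ.+ k)) (mulSym f g)) (coeffSym-mulTerm-≢ones c μ g sμ homg ne) ⟩
  coeffSym (ones (m ℕ.+ k)) (mulSym f g)
    ≈⟨ coeffSym-mulSym-ones m k f g homf homg ⟩
  coeffSym (ones m) f *P coeffSym (ones k) g
    ∎
  where open ≋-Reasoning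

sumℕ-map-* : ∀ k l → sumℕ (map (k ℕ.*_) l) ≡ k ℕ.* sumℕ l
sumℕ-map-* k []      = sym (ℕP.*-zeroʳ k)
sumℕ-map-* k (j ∷ l) = trans (cong (k ℕ.* j ℕ.+_) (sumℕ-map-* k l)) (sym (ℕP.*-distribˡ-+ k j (sumℕ l)))

homogeneous-pk : ∀ {a} k g → Homogeneous a g → Homogeneous (k ℕ.* a) (pk[ k ] g)
homogeneous-pk k []             []            = []
homogeneous-pk k ((c , λ′) ∷ g) (refl ∷ homg) = sumℕ-map-* k λ′ ∷ homogeneous-pk k g homg

pk[1]-identity : ∀ g → pk[ 1 ] g ≡ g
pk[1]-identity []             = refl
pk[1]-identity ((c , λ′) ∷ g) = cong₂ _∷_ (cong₂ _,_ (substPow-1 c) (map-1* λ′)) (pk[1]-identity g)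
  where
  substPow-1 : ∀ p → substPow 1 p ≡ p
  substPow-1 []      = refl
  substPow-1 (a ∷ p) = cong (a ∷_) (substPow-1 p)
  map-1* : ∀ l → map (1 ℕ.*_) l ≡ l
  map-1* []      = refl
  map-1* (j ∷ l) = cong₂ _∷_ (ℕP.*-identityˡ j) (map-1* l)

-- every part of a partition in p_k[g] is a multiple of k, so none is 1 unless k = 1
coeffSym-pk-≢1 : ∀ {a} k g N → .{{NonZero a}} → Homogeneous a g → k ≢ 1 → coeffSym (ones N) (pk[ k ] g) ≡ []
coeffSym-pk-≢1 k []             N []            k≢1 = refl
coeffSym-pk-≢1 k ((c , λ′) ∷ g) N (sλ′ ∷ homg) k≢1 with ≡-dec ℕ._≟_ (ones N) (map (k ℕ.*_) λ′)
... | no  _  = coeffSym-pk-≢1 k g N homg k≢1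
... | yes eq = ⊥-elim (impossible λ′ N sλ′ eq)
  where
  impossible : ∀ {a} λ′ N → .{{NonZero a}} → sumℕ λ′ ≡ a → ones N ≢ map (k ℕ.*_) λ′
  impossible {a} []  N       sλ′ _ = ℕ.≢-nonZero⁻¹ a (sym sλ′)
  impossible (j ∷ λ′) zero    _   ()
  impossible (j ∷ λ′) (suc N) _   eq = k≢1 (ℕP.m*n≡1⇒m≡1 k j (sym (ListP.∷-injectiveˡ eq)))

pleth-p : List ℕ → SymP → SymP
pleth-p μ g = prodSym (map (λ k → pk[ k ] g) μ)

private
  ka+as≡a[k+s] : ∀ a k s → k ℕ.* a ℕ.+ a ℕ.* s ≡ a ℕ.* (k ℕ.+ s)
  ka+as≡a[k+s] a k s = trans (cong (ℕ._+ a ℕ.* s) (ℕP.*-comm k a)) (sym (ℕP.*-distribˡ-+ a k s))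

homogeneous-pleth-p : ∀ {a} μ g → Homogeneous a g → Homogeneous (a ℕ.* sumℕ μ) (pleth-p μ g)
homogeneous-pleth-p {a} []      g homg = sym (ℕP.*-zeroʳ a) ∷ []
homogeneous-pleth-p {a} (k ∷ μ) g homg = subst (λ n → Homogeneous n (pleth-p (k ∷ μ) g)) (ka+as≡a[k+s] a k (sumℕ μ))
  (homogeneous-mulSym (pk[ k ] g) (pleth-p μ g) (homogeneous-pk k g homg) (homogeneous-pleth-p μ g homg))

coeffSym-pleth-p-∷ : ∀ {a} k μ g → Homogeneous a g →
  coeffSym (ones (a ℕ.* sumℕ (k ∷ μ))) (pleth-p (k ∷ μ) g)
    ≋ coeffSym (ones (k ℕ.* a)) (pk[ k ] g) *P coeffSym (ones (a ℕ.* sumℕ μ)) (pleth-p μ g)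
coeffSym-pleth-p-∷ {a} k μ g homg = subst (λ n → coeffSym (ones n) (pleth-p (k ∷ μ) g) ≋ rhs) (ka+as≡a[k+s] a k (sumℕ μ))
  (coeffSym-mulSym-ones (k ℕ.* a) (a ℕ.* sumℕ μ) (pk[ k ] g) (pleth-p μ g) (homogeneous-pk k g homg) (homogeneous-pleth-p μ g homg))
  where
  rhs : Poly
  rhs = coeffSym (ones (k ℕ.* a)) (pk[ k ] g) *P coeffSym (ones (a ℕ.* sumℕ μ)) (pleth-p μ g)

coeffSym-pleth-p-≢1 : ∀ {a} k μ g → .{{NonZero a}} → Homogeneous a g → k ≢ 1 →
  coeffSym (ones (a ℕ.* sumℕ (k ∷ μ))) (pleth-p (k ∷ μ) g) ≋ []
coeffSym-pleth-p-≢1 {a} k μ g homg k≢1 = ≋-trans (coeffSym-pleth-p-∷ k μ g homg)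
  (≋-reflexive (cong (_*P coeffSym (ones (a ℕ.* sumℕ μ)) (pleth-p μ g)) (coeffSym-pk-≢1 k g (k ℕ.* a) homg k≢1)))

*P-if-[] : ∀ p b q → p *P (if b then q else []) ≋ (if b then p *P q else [])
*P-if-[] p true  q = ≋-refl
*P-if-[] p false q = *P-zeroʳ p

coeffSym-pleth-p : ∀ {a} μ g → .{{NonZero a}} → Homogeneous a g →
  coeffSym (ones (a ℕ.* sumℕ μ)) (pleth-p μ g) ≋ (if allOnes μ then coeffSym (ones a) g ^P length μ else [])
coeffSym-pleth-p {a} []                g homg rewrite ℕP.*-zeroʳ a = ≋-refl
coeffSym-pleth-p {a} (zero ∷ μ)        g homg = coeffSym-pleth-p-≢1 0 μ g homg (λ ())
coeffSym-pleth-p {a} (suc (suc k) ∷ μ) g homg = coeffSym-pleth-p-≢1 (2 ℕ.+ k) μ g homg (λ ())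
coeffSym-pleth-p {a} (suc zero ∷ μ)    g homg = begin
  coeffSym (ones (a ℕ.* sumℕ (1 ∷ μ))) (pleth-p (1 ∷ μ) g)
    ≈⟨ coeffSym-pleth-p-∷ 1 μ g homg ⟩
  coeffSym (ones (1 ℕ.* a)) (pk[ 1 ] g) *P coeffSym (ones (a ℕ.* sumℕ μ)) (pleth-p μ g)
    ≡⟨ cong₂ (λ n h → coeffSym (ones n) h *P coeffSym (ones (a ℕ.* sumℕ μ)) (pleth-p μ g)) (ℕP.*-identityˡ a) (pk[1]-identity g) ⟩
  Φ *P coeffSym (ones (a ℕ.* sumℕ μ)) (pleth-p μ g)
    ≈⟨ *P-congʳ Φ (coeffSym-pleth-p μ g homg) ⟩
  Φ *P (if allOnes μ then Φ ^P length μ else [])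
    ≈⟨ *P-if-[] Φ (allOnes μ) (Φ ^P length μ) ⟩
  (if allOnes μ then Φ ^P suc (length μ) else [])
    ∎
  where
  open ≋-Reasoning
  Φ : Poly
  Φ = coeffSym (ones a) g

partsB-sum : ∀ f n m → All (λ μ → sumℕ μ ≡ n) (partsB f n m)
partsB-sum f       zero    m = refl ∷ []
partsB-sum zero    (suc n) m = []
partsB-sum (suc f) (suc n) m = AllP.concat⁺ (AllP.map⁺ (AllP.applyUpTo⁺₁ suc (suc n ⊓ m) λ {i} i<n⊓m →
  AllP.map⁺ (All.map (λ sμ → trans (cong (suc i ℕ.+_) sμ) (ℕP.m+[n∸m]≡n (ℕP.≤-trans i<n⊓m (ℕP.m⊓n≤m (suc n) m))))
    (partsB-sum f (suc n ∸ suc i) (suc i)))))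

-- partsB f n (suc m) is 1ⁿ followed by partitions with a part > 1
sumP-partsB : ∀ f n m (F : List ℕ → Poly) → n ≤ f → (∀ μ → sumℕ μ ≡ n → allOnes μ ≡ false → F μ ≋ []) →
  sumP (map F (partsB f n (suc m))) ≋ F (ones n)
sumP-partsB f       zero    m F _         _       = ≋-reflexive (+P-identityʳ (F []))
sumP-partsB (suc f) (suc n) m F (s≤s n≤f) F-vanish = begin
  sumP (map F (withHead1 ++ withHeadAbove1))                 ≡⟨ cong sumP (ListP.map-++ F withHead1 withHeadAbove1) ⟩
  sumP (map F withHead1 ++ map F withHeadAbove1)             ≈⟨ sumP-++ (map F withHead1) (map F withHeadAbove1) ⟩
  sumP (map F withHead1) +P sumP (map F withHeadAbove1)      ≈⟨ +P-cong head1 headAbove1 ⟩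
  F (ones (suc n)) +P []                                     ≡⟨ +P-identityʳ (F (ones (suc n))) ⟩
  F (ones (suc n))                                           ∎
  where
  open ≋-Reasoning
  withHead1 withHeadAbove1 : List (List ℕ)
  withHead1      = map (1 ∷_) (partsB f n 1)
  withHeadAbove1 = concatMap (λ k → map (k ∷_) (partsB f (suc n ∸ k) k)) (applyUpTo (suc ∘′ suc) (n ⊓ m))
  head1 : sumP (map F withHead1) ≋ F (ones (suc n))
  head1 = ≋-trans (≋-reflexive (cong sumP (sym (ListP.map-∘ (partsB f n 1)))))
    (sumP-partsB f n 0 (λ μ → F (1 ∷ μ)) n≤f (λ μ sμ all1 → F-vanish (1 ∷ μ) (cong suc sμ) all1))
  headAbove1 : sumP (map F withHeadAbove1) ≋ []
  headAbove1 = sumP-map-≋[] F (AllP.concat⁺ (AllP.map⁺ (AllP.applyUpTo⁺₁ (suc ∘′ suc) (n ⊓ m) λ {i} i<n⊓m →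
    AllP.map⁺ (All.map (λ {μ} sμ → F-vanish (2 ℕ.+ i ∷ μ)
        (trans (cong (2 ℕ.+ i ℕ.+_) sμ) (ℕP.m+[n∸m]≡n (s≤s (ℕP.≤-trans i<n⊓m (ℕP.m⊓n≤m n m))))) refl)
      (partsB-sum f (suc n ∸ (2 ℕ.+ i)) (2 ℕ.+ i))))))

sumP-partitions : ∀ n (F : List ℕ → Poly) → (∀ μ → sumℕ μ ≡ n → allOnes μ ≡ false → F μ ≋ []) →
  sumP (map F (partitions n)) ≋ F (ones n)
sumP-partitions zero    F F-vanish = ≋-reflexive (+P-identityʳ (F []))
sumP-partitions (suc n) F F-vanish = sumP-partsB (suc n) (suc n) n F ℕP.≤-refl F-vanish

coeffSym-ones-tabulate-partitions : ∀ n (h : List ℕ → Poly) → coeffSym (ones n) (map (λ μ → (h μ , μ)) (partitions n)) ≋ h (ones n)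
coeffSym-ones-tabulate-partitions n h = begin
  coeffSym (ones n) (map (λ μ → (h μ , μ)) (partitions n))    ≈⟨ coeffSym-tabulate (ones n) h (partitions n) ⟩
  sumP (map (λ μ → select (ones n) μ (h μ)) (partitions n))    ≈⟨ sumP-partitions n (λ μ → select (ones n) μ (h μ)) vanish ⟩
  select (ones n) (ones n) (h (ones n))                       ≡⟨ select-refl (ones n) (h (ones n)) ⟩
  h (ones n)                                                  ∎
  where
  open ≋-Reasoning
  vanish : ∀ μ → sumℕ μ ≡ n → allOnes μ ≡ false → select (ones n) μ (h μ) ≋ []
  vanish μ _ all1≡false = ≋-reflexive (select-≢ (h μ) λ ones≡μ →
    true≢false (trans (sym (allOnes-ones n)) (trans (cong allOnes ones≡μ) all1≡false)))
    where
    true≢false : true ≢ false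
    true≢false ()

prodℕ-ones : ∀ n → prodℕ (ones n) ≡ 1
prodℕ-ones zero    = refl
prodℕ-ones (suc n) = trans (ℕP.*-identityˡ (prodℕ (ones n))) (prodℕ-ones n)

countℕ-0-ones : ∀ n → countℕ 0 (ones n) ≡ 0
countℕ-0-ones zero    = refl
countℕ-0-ones (suc n) = countℕ-0-ones n

countℕ-1-ones : ∀ n → countℕ 1 (ones n) ≡ n
countℕ-1-ones zero    = refl
countℕ-1-ones (suc n) = cong suc (countℕ-1-ones n)

countℕ-2+-ones : ∀ j n → countℕ (2 ℕ.+ j) (ones n) ≡ 0
countℕ-2+-ones j zero    = refl
countℕ-2+-ones j (suc n) = countℕ-2+-ones j n

prodℕ-map-0! : ∀ (c : ℕ → ℕ) {js} → All (λ j → c j ≡ 0) js → prodℕ (map (λ j → c j !) js) ≡ 1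
prodℕ-map-0! c []          = refl
prodℕ-map-0! c (cj≡0 ∷ cs) = cong₂ (λ x y → x ! ℕ.* y) cj≡0 (prodℕ-map-0! c cs)

prodℕ-count!-ones : ∀ n → prodℕ (map (λ j → countℕ j (ones n) !) (upTo (suc n))) ≡ n !
prodℕ-count!-ones zero    = refl
prodℕ-count!-ones (suc n) = begin
  countℕ 0 (ones (suc n)) ! ℕ.* (countℕ 1 (ones (suc n)) ! ℕ.* rest)
    ≡⟨ cong₂ (λ c₀ c₁ → c₀ ! ℕ.* (c₁ ! ℕ.* rest)) (countℕ-0-ones (suc n)) (countℕ-1-ones (suc n)) ⟩
  1 ℕ.* (suc n ! ℕ.* rest)
    ≡⟨ cong (λ r → 1 ℕ.* (suc n ! ℕ.* r))
            (prodℕ-map-0! (λ j → countℕ j (ones (suc n))) (AllP.applyUpTo⁺₂ (suc ∘′ suc) n (λ j → countℕ-2+-ones j (suc n)))) ⟩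
  1 ℕ.* (suc n ! ℕ.* 1)
    ≡⟨ trans (ℕP.*-identityˡ _) (ℕP.*-identityʳ (suc n !)) ⟩
  suc n !
    ∎
  where
  open ≡-Reasoning
  rest : ℕ
  rest = prodℕ (map (λ j → countℕ j (ones (suc n)) !) (applyUpTo (suc ∘′ suc) n))

zee-ones : ∀ n → zee (ones n) ≡ n !
zee-ones n = begin
  prodℕ (ones n) ℕ.* prodℕ (map (λ j → countℕ j (ones n) !) (upTo (suc (sumℕ (ones n)))))
    ≡⟨ cong₂ (λ p s → p ℕ.* prodℕ (map (λ j → countℕ j (ones n) !) (upTo (suc s)))) (prodℕ-ones n) (sumℕ-ones n) ⟩
  1 ℕ.* prodℕ (map (λ j → countℕ j (ones n) !) (upTo (suc n)))
    ≡⟨ trans (ℕP.*-identityˡ _) (prodℕ-count!-ones n) ⟩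
  n !
    ∎
  where open ≡-Reasoning

divS-[] : ∀ f p → length p ≤ f → divS f p [] ≡ p
divS-[] zero    []      _         = refl
divS-[] (suc f) []      _         = refl
divS-[] (suc f) (c ∷ p) (s≤s len) = cong (c ∷_) (trans (cong (λ q → divS f q []) (+P-identityʳ p)) (divS-[] f p len))

divQInts-ones : ∀ n p → divQInts (ones n) p ≡ p
divQInts-ones zero    p = refl
divQInts-ones (suc n) p = trans (divS-[] _ (divQInts (ones n) p) ℕP.≤-refl) (divQInts-ones n p)

Hcoeff-ones : ∀ n → Hcoeff n (ones n) ≋ recipℕ (n !) ·P qfact n
Hcoeff-ones n = begin
  recipℕ (zee (ones n)) ·P (divQInts (ones n) (qfact n) *P (oneMinusQ ^P (n ∸ length (ones n))))
    ≡⟨ cong₂ (λ z k → recipℕ z ·P (divQInts (ones n) (qfact n) *P (oneMinusQ ^P k))) (zee-ones n) n∸ℓ≡0 ⟩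
  recipℕ (n !) ·P (divQInts (ones n) (qfact n) *P oneP)
    ≡⟨ cong (λ p → recipℕ (n !) ·P (p *P oneP)) (divQInts-ones n (qfact n)) ⟩
  recipℕ (n !) ·P (qfact n *P oneP)
    ≈⟨ ·P-congʳ (recipℕ (n !)) (*P-identityʳ (qfact n)) ⟩
  recipℕ (n !) ·P qfact n
    ∎
  where
  open ≋-Reasoning
  n∸ℓ≡0 : n ∸ length (ones n) ≡ 0
  n∸ℓ≡0 = trans (cong (n ∸_) (ListP.length-replicate n)) (ℕP.n∸n≡0 n)

homogeneous-H : ∀ n → Homogeneous n (H n)
homogeneous-H n = AllP.map⁺ (partsB-sum n n n)

coeffSym-ones-H : ∀ n → coeffSym (ones n) (H n) ≋ recipℕ (n !) ·P qfact n
coeffSym-ones-H n = ≋-trans (coeffSym-ones-tabulate-partitions n (Hcoeff n)) (Hcoeff-ones n)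

coeffSym-ones-pleth-H : ∀ a b .{{_ : NonZero a}} → coeffSym (ones (a ℕ.* b)) (pleth (H b) (H a)) ≋ plethCoeff a b
coeffSym-ones-pleth-H a b = begin
  coeffSym (ones (a ℕ.* b)) (pleth (H b) (H a))
    ≈⟨ coeffSym-concatMap (ones (a ℕ.* b)) term (H b) ⟩
  sumP (map (λ e → coeffSym (ones (a ℕ.* b)) (term e)) (H b))
    ≈⟨ sumP-map-cong (H b) (λ e → coeffSym-scale (ones (a ℕ.* b)) (proj₁ e) (pleth-p (proj₂ e) (H a))) ⟩
  sumP (map (λ e → proj₁ e *P coeffSym (ones (a ℕ.* b)) (pleth-p (proj₂ e) (H a))) (H b))
    ≡⟨ cong sumP (sym (ListP.map-∘ (partitions b))) ⟩
  sumP (map (λ μ → Hcoeff b μ *P coeffSym (ones (a ℕ.* b)) (pleth-p μ (H a))) (partitions b))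
    ≈⟨ sumP-partitions b _ vanish ⟩
  Hcoeff b (ones b) *P coeffSym (ones (a ℕ.* b)) (pleth-p (ones b) (H a))
    ≈⟨ *P-cong (Hcoeff-ones b) (coeffSym-pleth-p-sum (ones b) (sumℕ-ones b)) ⟩
  (recipℕ (b !) ·P qfact b) *P (if allOnes (ones b) then Φ ^P length (ones b) else [])
    ≡⟨ cong₂ (λ t ℓ → (recipℕ (b !) ·P qfact b) *P (if t then Φ ^P ℓ else [])) (allOnes-ones b) (ListP.length-replicate b) ⟩
  (recipℕ (b !) ·P qfact b) *P (Φ ^P b)
    ≈⟨ *P-congʳ (recipℕ (b !) ·P qfact b) (^P-congˡ b (coeffSym-ones-H a)) ⟩
  (recipℕ (b !) ·P qfact b) *P ((recipℕ (a !) ·P qfact a) ^P b)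
    ≈⟨ plethCoeff-factorisation a b ⟩
  plethCoeff a b
    ∎
  where
  open ≋-Reasoning
  term : Poly × List ℕ → SymP
  term e = map (λ e′ → (proj₁ e *P proj₁ e′ , proj₂ e′)) (pleth-p (proj₂ e) (H a))
  Φ : Poly
  Φ = coeffSym (ones a) (H a)
  coeffSym-pleth-p-sum : ∀ μ → sumℕ μ ≡ b →
    coeffSym (ones (a ℕ.* b)) (pleth-p μ (H a)) ≋ (if allOnes μ then Φ ^P length μ else [])
  coeffSym-pleth-p-sum μ refl = coeffSym-pleth-p μ (H a) (homogeneous-H a)
  vanish : ∀ μ → sumℕ μ ≡ b → allOnes μ ≡ false → Hcoeff b μ *P coeffSym (ones (a ℕ.* b)) (pleth-p μ (H a)) ≋ []
  vanish μ sμ all1≡false = begin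
    Hcoeff b μ *P coeffSym (ones (a ℕ.* b)) (pleth-p μ (H a))
      ≈⟨ *P-congʳ (Hcoeff b μ) (coeffSym-pleth-p-sum μ sμ) ⟩
    Hcoeff b μ *P (if allOnes μ then Φ ^P length μ else [])
      ≡⟨ cong (λ t → Hcoeff b μ *P (if t then Φ ^P length μ else [])) all1≡false ⟩
    Hcoeff b μ *P []
      ≈⟨ *P-zeroʳ (Hcoeff b μ) ⟩
    []                                                                 ∎

dimP-coeffSym : ∀ n f → dimP n f ≋ fromℕℚ (n !) ·P coeffSym (ones n) f
dimP-coeffSym n []             = ≋-refl
dimP-coeffSym n ((d , λ′) ∷ f) with ≡-dec ℕ._≟_ (ones n) λ′
... | yes _ = begin
  (z ·P (oneP *P d)) +P dimP n f
    ≈⟨ +P-cong (·P-congʳ z (*P-identityˡ d)) (dimP-coeffSym n f) ⟩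
  (z ·P d) +P (fromℕℚ (n !) ·P coeffSym (ones n) f)
    ≡⟨ cong (λ m → (fromℕℚ m ·P d) +P (fromℕℚ (n !) ·P coeffSym (ones n) f)) (zee-ones n) ⟩
  (fromℕℚ (n !) ·P d) +P (fromℕℚ (n !) ·P coeffSym (ones n) f)
    ≈⟨ ·P-distrib-+P (fromℕℚ (n !)) d (coeffSym (ones n) f) ⟨
  fromℕℚ (n !) ·P (d +P coeffSym (ones n) f)
    ∎
  where
  open ≋-Reasoning
  z : ℚ
  z = fromℕℚ (zee (ones n))
... | no _ = dimP-coeffSym n f

dimQ-at1 : ∀ n f → dimQ n (at1 f) ≡ fromℕℚ (n !) * ev₁ (coeffSym (ones n) f)
dimQ-at1 n []             = sym (ℚP.*-zeroʳ (fromℕℚ (n !)))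
dimQ-at1 n ((c , λ′) ∷ f) with ≡-dec ℕ._≟_ (ones n) λ′
... | yes _ = begin
  fromℕℚ (zee (ones n)) * (1ℚ * evalP 1ℚ c) + dimQ n (at1 f)
    ≡⟨ cong₂ _+_ (cong₂ _*_ (cong fromℕℚ (zee-ones n)) (trans (ℚP.*-identityˡ _) (evalP-1 c))) (dimQ-at1 n f) ⟩
  fromℕℚ (n !) * ev₁ c + fromℕℚ (n !) * ev₁ (coeffSym (ones n) f)
    ≡⟨ ℚP.*-distribˡ-+ (fromℕℚ (n !)) (ev₁ c) _ ⟨
  fromℕℚ (n !) * (ev₁ c + ev₁ (coeffSym (ones n) f))
    ≡⟨ cong (fromℕℚ (n !) *_) (ev₁-+P c (coeffSym (ones n) f)) ⟨
  fromℕℚ (n !) * ev₁ (c +P coeffSym (ones n) f)                  ∎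
  where open ≡-Reasoning
... | no _ = trans (ℚP.+-identityˡ (dimQ n (at1 f))) (dimQ-at1 n f)

Fnumerator : ℕ → ℕ → SymP
Fnumerator a b = pleth (H b) (H a) -Sym pleth (H a) (H b)

coeffSym-ones-Fnumerator : ∀ a b .{{_ : NonZero a}} .{{_ : NonZero b}} →
  coeffSym (ones (a ℕ.* b)) (Fnumerator a b) ≋ plethCoeff a b -P plethCoeff b a
coeffSym-ones-Fnumerator a b = ≋-trans (coeffSym--Sym (ones (a ℕ.* b)) (pleth (H b) (H a)) (pleth (H a) (H b)))
  (+P-cong (coeffSym-ones-pleth-H a b)
           (-P-cong (subst (λ n → coeffSym (ones n) (pleth (H a) (H b)) ≋ plethCoeff b a) (ℕP.*-comm b a) (coeffSym-ones-pleth-H b a))))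

ev₁-coeffSym-ones-Fnumerator : ∀ a b .{{_ : NonZero a}} .{{_ : NonZero b}} → ev₁ (coeffSym (ones (a ℕ.* b)) (Fnumerator a b)) ≡ 0ℚ
ev₁-coeffSym-ones-Fnumerator a b = begin
  ev₁ (coeffSym (ones (a ℕ.* b)) (Fnumerator a b))   ≡⟨ ev₁-cong (coeffSym-ones-Fnumerator a b) ⟩
  ev₁ (plethCoeff a b -P plethCoeff b a)             ≡⟨ ev₁-+P (plethCoeff a b) (-P plethCoeff b a) ⟩
  ev₁ (plethCoeff a b) + ev₁ (-P plethCoeff b a)     ≡⟨ cong (λ x → ev₁ (plethCoeff a b) + x) (ev₁--P (plethCoeff b a)) ⟩
  ev₁ (plethCoeff a b) - ev₁ (plethCoeff b a)        ≡⟨ cong₂ _-_ (ev₁-plethCoeff a b) (ev₁-plethCoeff b a) ⟩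
  1ℚ - 1ℚ                                            ≡⟨ ℚP.+-inverseʳ 1ℚ ⟩
  0ℚ                                                 ∎
  where open ≡-Reasoning

oneMinusQ-*P-coeffSym-ones-F : ∀ a b .{{_ : NonZero a}} .{{_ : NonZero b}} →
  oneMinusQ *P coeffSym (ones (a ℕ.* b)) (F a b) ≋ plethCoeff a b -P plethCoeff b a
oneMinusQ-*P-coeffSym-ones-F a b = begin
  oneMinusQ *P coeffSym (ones (a ℕ.* b)) (F a b)
    ≈⟨ *P-congʳ oneMinusQ (coeffSym-ones-tabulate-partitions (a ℕ.* b) (λ μ → divOneMinusQ (coeffSym μ (Fnumerator a b)))) ⟩
  oneMinusQ *P divOneMinusQ numerator
    ≈⟨ divOneMinusQ-correct numerator (ev₁-coeffSym-ones-Fnumerator a b) ⟩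
  numerator
    ≈⟨ coeffSym-ones-Fnumerator a b ⟩
  plethCoeff a b -P plethCoeff b a                    ∎
  where
  open ≋-Reasoning
  numerator : Poly
  numerator = coeffSym (ones (a ℕ.* b)) (Fnumerator a b)

oneMinusQ-*P-dimP-F : ∀ a b .{{_ : NonZero a}} .{{_ : NonZero b}} →
  oneMinusQ *P dimP (a ℕ.* b) (F a b) ≋ fromℕℚ ((a ℕ.* b) !) ·P (plethCoeff a b -P plethCoeff b a)
oneMinusQ-*P-dimP-F a b = begin
  oneMinusQ *P dimP n (F a b)                                ≈⟨ *P-congʳ oneMinusQ (dimP-coeffSym n (F a b)) ⟩
  oneMinusQ *P (fromℕℚ (n !) ·P coeffSym (ones n) (F a b))   ≈⟨ *P-·P-comm (fromℕℚ (n !)) oneMinusQ (coeffSym (ones n) (F a b)) ⟩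
  fromℕℚ (n !) ·P (oneMinusQ *P coeffSym (ones n) (F a b))   ≈⟨ ·P-congʳ (fromℕℚ (n !)) (oneMinusQ-*P-coeffSym-ones-F a b) ⟩
  fromℕℚ (n !) ·P (plethCoeff a b -P plethCoeff b a)         ∎
  where
  open ≋-Reasoning
  n : ℕ
  n = a ℕ.* b

ev₁-coeffSym-ones-F : ∀ a b .{{_ : NonZero a}} .{{_ : NonZero b}} →
  fromℕℚ 4 * ev₁ (coeffSym (ones (a ℕ.* b)) (F a b)) ≡ (orderedPairs a + fromℕℚ a * orderedPairs b) - (orderedPairs b + fromℕℚ b * orderedPairs a)
ev₁-coeffSym-ones-F a b = begin
  four * ev₁ c
    ≡⟨ solve 2 (λ f v → f :* v := :- (f :* (:- v))) refl four (ev₁ c) ⟩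
  - (four * - ev₁ c)
    ≡⟨ cong (λ x → - (four * x)) (sym (deriv₁-oneMinusQ-*P c)) ⟩
  - (four * deriv₁ (oneMinusQ *P c))
    ≡⟨ cong (λ x → - (four * x)) (deriv₁-cong (oneMinusQ-*P-coeffSym-ones-F a b)) ⟩
  - (four * deriv₁ (plethCoeff a b -P plethCoeff b a))
    ≡⟨ cong (λ x → - (four * x)) deriv₁-difference ⟩
  - (four * (deriv₁ (plethCoeff a b) - deriv₁ (plethCoeff b a)))
    ≡⟨ solve 3 (λ f x y → :- (f :* (x :+ (:- y))) := f :* y :+ (:- (f :* x))) refl four (deriv₁ (plethCoeff a b)) (deriv₁ (plethCoeff b a)) ⟩
  four * deriv₁ (plethCoeff b a) - four * deriv₁ (plethCoeff a b)
    ≡⟨ cong₂ _-_ (deriv₁-plethCoeff b a) (deriv₁-plethCoeff a b) ⟩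
  (orderedPairs a + fromℕℚ a * orderedPairs b) - (orderedPairs b + fromℕℚ b * orderedPairs a)
    ∎
  where
  open ≡-Reasoning
  four : ℚ
  four = fromℕℚ 4
  c : Poly
  c = coeffSym (ones (a ℕ.* b)) (F a b)
  deriv₁-difference : deriv₁ (plethCoeff a b -P plethCoeff b a) ≡ deriv₁ (plethCoeff a b) - deriv₁ (plethCoeff b a)
  deriv₁-difference = trans (deriv₁-+P (plethCoeff a b) (-P plethCoeff b a))
    (cong (λ x → deriv₁ (plethCoeff a b) + x) (deriv₁--P (plethCoeff b a)))

orderedPairs-difference : ∀ {a b} → 1 ≤ a → a ≤ b →
  (orderedPairs a + fromℕℚ a * orderedPairs b) - (orderedPairs b + fromℕℚ b * orderedPairs a) ≡ fromℕℚ ((a ∸ 1) ℕ.* (b ∸ 1) ℕ.* (b ∸ a))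
orderedPairs-difference {a} {b} 1≤a a≤b = begin
  (orderedPairs a + A * orderedPairs b) - (orderedPairs b + B * orderedPairs a)
    ≡⟨ solve 2 (λ A B → let orderedPairsₑ = λ X → X :* (X :+ (:- con 1ℚ)) in
                   (orderedPairsₑ A :+ A :* orderedPairsₑ B) :+ (:- (orderedPairsₑ B :+ B :* orderedPairsₑ A))
                     := (A :+ (:- con 1ℚ)) :* (B :+ (:- con 1ℚ)) :* (B :+ (:- A))) refl A B ⟩
  (A - 1ℚ) * (B - 1ℚ) * (B - A)
    ≡⟨ cong₂ _*_ (cong₂ _*_ (sym (fromℕℚ-∸ 1≤a)) (sym (fromℕℚ-∸ (ℕP.≤-trans 1≤a a≤b)))) (sym (fromℕℚ-∸ a≤b)) ⟩
  fromℕℚ (a ∸ 1) * fromℕℚ (b ∸ 1) * fromℕℚ (b ∸ a)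
    ≡⟨ cong (_* fromℕℚ (b ∸ a)) (fromℕℚ-* (a ∸ 1) (b ∸ 1)) ⟨
  fromℕℚ ((a ∸ 1) ℕ.* (b ∸ 1)) * fromℕℚ (b ∸ a)
    ≡⟨ fromℕℚ-* ((a ∸ 1) ℕ.* (b ∸ 1)) (b ∸ a) ⟨
  fromℕℚ ((a ∸ 1) ℕ.* (b ∸ 1) ℕ.* (b ∸ a))            ∎
  where
  open ≡-Reasoning
  A B : ℚ
  A = fromℕℚ a
  B = fromℕℚ b

dimQ-at1-F : ∀ a b .{{_ : NonZero a}} .{{_ : NonZero b}} → a ≤ b →
  dimQ (a ℕ.* b) (at1 (F a b)) ≡ (+ ((a ℕ.* b) ! ℕ.* (a ∸ 1) ℕ.* (b ∸ 1) ℕ.* (b ∸ a))) / 4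
dimQ-at1-F a b a≤b = begin
  dimQ n (at1 (F a b))         ≡⟨ dimQ-at1 n (F a b) ⟩
  N * ev₁ c                    ≡⟨ fromℕℚ-*-cancelˡ 4 fourfold ⟩
  fromℕℚ K * recipℕ 4          ≡⟨ /-as-recipℕ K 3 ⟨
  (+ K) / 4                    ∎
  where
  open ≡-Reasoning
  n K : ℕ
  n = a ℕ.* b
  K = n ! ℕ.* (a ∸ 1) ℕ.* (b ∸ 1) ℕ.* (b ∸ a)
  N : ℚ
  N = fromℕℚ (n !)
  c : Poly
  c = coeffSym (ones n) (F a b)
  fourfold : fromℕℚ 4 * (N * ev₁ c) ≡ fromℕℚ K
  fourfold = begin
    fromℕℚ 4 * (N * ev₁ c)
      ≡⟨ solve 3 (λ f m v → f :* (m :* v) := m :* (f :* v)) refl (fromℕℚ 4) N (ev₁ c) ⟩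
    N * (fromℕℚ 4 * ev₁ c)
      ≡⟨ cong (N *_) (trans (ev₁-coeffSym-ones-F a b) (orderedPairs-difference (ℕ.>-nonZero⁻¹ a) a≤b)) ⟩
    N * fromℕℚ ((a ∸ 1) ℕ.* (b ∸ 1) ℕ.* (b ∸ a))
      ≡⟨ fromℕℚ-* (n !) ((a ∸ 1) ℕ.* (b ∸ 1) ℕ.* (b ∸ a)) ⟨
    fromℕℚ (n ! ℕ.* ((a ∸ 1) ℕ.* (b ∸ 1) ℕ.* (b ∸ a)))
      ≡⟨ cong fromℕℚ (reassoc (n !) (a ∸ 1) (b ∸ 1) (b ∸ a)) ⟩
    fromℕℚ K
      ∎
    where
    reassoc : ∀ w x y z → w ℕ.* (x ℕ.* y ℕ.* z) ≡ w ℕ.* x ℕ.* y ℕ.* z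
    reassoc w x y z = sym (trans (cong (ℕ._* z) (ℕP.*-assoc w x y)) (ℕP.*-assoc w (x ℕ.* y) z))

proposition2p1 : (a b : ℕ) → 0 < a → a < b →
    (oneMinusQ *P dimP (a Data.Nat.* b) (F a b))
      ≈P (fromℕℚ ((a Data.Nat.* b) !)
           ·P ((recipℕ (b ! Data.Nat.* ((a !) ^ b)) ·P (qfact b *P (qfact a ^P b)))
               -P (recipℕ (a ! Data.Nat.* ((b !) ^ a)) ·P (qfact a *P (qfact b ^P a)))))
    × (dimQ (a Data.Nat.* b) (at1 (F a b))
         ≡ (+ ((a Data.Nat.* b) ! Data.Nat.* (a ∸ 1) Data.Nat.* (b ∸ 1) Data.Nat.* (b ∸ a))) / 4)
proposition2p1 a b 0<a a<b = coeff≡ (oneMinusQ-*P-dimP-F a b) , dimQ-at1-F a b (ℕP.<⇒≤ a<b)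
  where
  instance
    a≢0 : NonZero a
    a≢0 = ℕ.>-nonZero 0<a
    b≢0 : NonZero b
    b≢0 = ℕ.>-nonZero (ℕP.<-trans 0<a a<b)
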